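{- Let $rr(n)$ be the number of partitions of $n$ into parts congruent to $\pm1\pmod 5$, i.e. $\sum_{n\ge0}rr(n)q^n=\prod_{j\ge0}\frac{1}{(1-q^{5j+1})(1-q^{5j+4})}$. Let $P_5:=\{m(3m\pm1)/2: m\in\mathbb N\}$, $\widehat P:=\{m(3m\pm1)/2: m\in\mathbb N,\ m\text{ even}\}$, and for a composition $c$ let $\widehat\ell(c)$ be the number of parts of $c$ in $\widehat P$. For $i\ge0$ set $a_i=1$ if $i=10j^2\pm j$ for some integer $j\ge0$; $a_i=-1$ if $i=10j^2\pm 9j+2$ for some integer $j\ge 0$; and $a_i=0$ otherwise. Then for every $n\ge0$, \[ rr(n)=\sum_{i=0}^n a_i\sum_{\substack{c\in\mathcal C_{P_5}\\ |c|=n-i}}(-1)^{\widehat\ell(c)}. \]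
   Context: A composition is an ordered finite sequence of positive integers (its parts), the empty composition included; $|c|$ is the sum of the parts; $\mathcal C_{S}$ is the set of compositions all of whose parts lie in $S$. Parts are counted with multiplicity in $\widehat\ell(c)$. -}

module Defs where

open import Data.Bool using (Bool; true; false; if_then_else_; _∧_; _∨_; not)
open import Data.Nat using (ℕ; zero; suc; _+_; _*_; _∸_; _%_; _≡ᵇ_; _≤ᵇ_)
open import Data.List using (List; []; _∷_; upTo; map; filter; concatMap; length; sum; foldr)
open import Data.List.Relation.Unary.Any using (any?)
open import Data.Integer using (ℤ; +_; -_)
open import Data.Bool using (T)
open import Relation.Nullary.Decidable using (T?)
import Data.Integer as ℤ

anyBelow : ℕ → (ℕ → Bool) → Bool
anyBelow n p = foldr (λ k b → p k ∨ b) false (upTo n)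

oneTo : ℕ → List ℕ
oneTo n = map suc (upTo n)

isPm1mod5 : ℕ → Bool
isPm1mod5 k = (k % 5 ≡ᵇ 1) ∨ (k % 5 ≡ᵇ 4)

-- k = m(3m-1)/2 or k = m(3m+1)/2 for some m ∈ ℕ (m ≤ k suffices);
-- written as 2k = m(3m-1) or 2k = m(3m+1)
isPentWith : (ℕ → Bool) → ℕ → Bool
isPentWith cond k = anyBelow (suc k) λ m →
  cond m ∧ ((2 * k ≡ᵇ m * (3 * m ∸ 1)) ∨ (2 * k ≡ᵇ m * (3 * m + 1)))

isP5 : ℕ → Bool
isP5 = isPentWith (λ _ → true)

isPhat : ℕ → Bool
isPhat = isPentWith (λ m → m % 2 ≡ᵇ 0)

-- all compositions of n with parts in S (fuel f ≥ n suffices since parts ≥ 1)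
compsF : (ℕ → Bool) → ℕ → ℕ → List (List ℕ)
compsF S f zero = [] ∷ []
compsF S zero (suc n) = []
compsF S (suc f) (suc n) =
  concatMap (λ p → map (p ∷_) (compsF S f (suc n ∸ p))) (filter (λ p → T? (S p)) (oneTo (suc n)))

compositions : (ℕ → Bool) → ℕ → List (List ℕ)
compositions S n = compsF S n n

-- all partitions of n (as non-increasing lists) with parts in S and ≤ k
partsF : (ℕ → Bool) → ℕ → ℕ → ℕ → List (List ℕ)
partsF S f k zero = [] ∷ []
partsF S zero k (suc n) = []
partsF S (suc f) k (suc n) =
  concatMap (λ p → map (p ∷_) (partsF S f p (suc n ∸ p)))
    (filter (λ p → T? (S p ∧ (p ≤ᵇ k))) (oneTo (suc n)))

partitions : (ℕ → Bool) → ℕ → List (List ℕ)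
partitions S n = partsF S n n n

rr : ℕ → ℕ
rr n = length (partitions isPm1mod5 n)

ellHat : List ℕ → ℕ
ellHat c = length (filter (λ p → T? (isPhat p)) c)

signPow : ℕ → ℤ
signPow zero = + 1
signPow (suc k) = - signPow k

signedCount : ℕ → ℤ
signedCount m = foldr (λ c acc → signPow (ellHat c) ℤ.+ acc) (+ 0) (compositions isP5 m)

-- a_i : i = 10j² ± j  ↦ 1 ;  i = 10j² ± 9j + 2 ↦ -1 ; else 0   (j ≥ 0, j ≤ i suffices)
isPlus : ℕ → Bool
isPlus i = anyBelow (suc i) λ j →
  (i + j ≡ᵇ 10 * j * j) ∨ (i ≡ᵇ 10 * j * j + j)

isMinus : ℕ → Bool
isMinus i = anyBelow (suc i) λ j →
  (i + 9 * j ≡ᵇ 10 * j * j + 2) ∨ (i ≡ᵇ 10 * j * j + 9 * j + 2)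

a : ℕ → ℤ
a i = if isPlus i then + 1 else (if isMinus i then - (+ 1) else + 0)

sumTo : ℕ → (ℕ → ℤ) → ℤ
sumTo n f = foldr (λ i acc → f i ℤ.+ acc) (+ 0) (upTo (suc n))

-- With P = ∏_{n ≥ 1} (1 - q^n), the generating function of rr times P is ∏_{n ≢ ±1 (mod 5)} (1 - q^n), which
-- Jacobi's triple product in q^5 (b = 2, c = 3) turns into Σ a_i q^i. The same identity in q^3 (b = 1, c = 2)
-- is Euler's pentagonal theorem P = 1 - Σ_{p ∈ P₅, p > 0} ε(p) q^p with ε(p) = -1 exactly for p ∈ P̂, so
-- 1/P = Σ_c Π ε(parts of c) = Σ_c (-1)^ℓ̂(c) q^|c| over compositions c with parts in P₅. Hence
-- rr = (Σ a_i q^i) / P is the stated convolution. The triple product is proved in a finite form, with Gaussian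
-- binomials in t = q^a, and infinite products only ever enter through their truncations below a fixed degree.

module Submission where

module FiniteSums where

  open import Data.Nat as ℕ using (ℕ; zero; suc; _∸_; _<_; z≤n; s≤s)
  import Data.Nat.Properties as ℕ
  open import Data.Integer using (ℤ; -_; _+_; _-_; _*_; 0ℤ)
  import Data.Integer.Properties as ℤ
  open import Data.Integer.Tactic.RingSolver using (solve-∀)
  open import Function using (_∘_)
  open import Relation.Binary.PropositionalEquality

  ∑ : ℕ → (ℕ → ℤ) → ℤ
  ∑ zero f = 0ℤ
  ∑ (suc n) f = f 0 + ∑ n (f ∘ suc)

  syntax ∑ n (λ i → e) = ∑[ i < n ] e

  ∑-cong : ∀ n {f g : ℕ → ℤ} → (∀ i → i < n → f i ≡ g i) → ∑ n f ≡ ∑ n g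
  ∑-cong zero eq = refl
  ∑-cong (suc n) eq = cong₂ _+_ (eq 0 (s≤s z≤n)) (∑-cong n (λ i i<n → eq (suc i) (s≤s i<n)))

  ∑-cong′ : ∀ n {f g : ℕ → ℤ} → (∀ i → f i ≡ g i) → ∑ n f ≡ ∑ n g
  ∑-cong′ n eq = ∑-cong n (λ i _ → eq i)

  ∑-zero : ∀ n (f : ℕ → ℤ) → (∀ i → i < n → f i ≡ 0ℤ) → ∑ n f ≡ 0ℤ
  ∑-zero zero f _ = refl
  ∑-zero (suc n) f eq =
    cong₂ _+_ (eq 0 (s≤s z≤n)) (∑-zero n (f ∘ suc) (λ i i<n → eq (suc i) (s≤s i<n)))

  ∑-+ : ∀ n (f g : ℕ → ℤ) → ∑[ i < n ] (f i + g i) ≡ ∑ n f + ∑ n g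
  ∑-+ zero f g = refl
  ∑-+ (suc n) f g rewrite ∑-+ n (f ∘ suc) (g ∘ suc) = interchange (f 0) (g 0) _ _
    where
    interchange : ∀ a b c d → a + b + (c + d) ≡ a + c + (b + d)
    interchange = solve-∀

  ∑-*ˡ : ∀ n c (f : ℕ → ℤ) → ∑[ i < n ] (c * f i) ≡ c * ∑ n f
  ∑-*ˡ zero c f = sym (ℤ.*-zeroʳ c)
  ∑-*ˡ (suc n) c f rewrite ∑-*ˡ n c (f ∘ suc) = sym (ℤ.*-distribˡ-+ c (f 0) _)

  ∑-*ʳ : ∀ n c (f : ℕ → ℤ) → ∑[ i < n ] (f i * c) ≡ ∑ n f * c
  ∑-*ʳ n c f = begin
    ∑[ i < n ] (f i * c)  ≡⟨ ∑-cong′ n (λ i → ℤ.*-comm (f i) c) ⟩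
    ∑[ i < n ] (c * f i)  ≡⟨ ∑-*ˡ n c f ⟩
    c * ∑ n f             ≡⟨ ℤ.*-comm c _ ⟩
    ∑ n f * c             ∎
    where open ≡-Reasoning

  ∑-neg : ∀ n (f : ℕ → ℤ) → ∑[ i < n ] (- f i) ≡ - ∑ n f
  ∑-neg zero f = refl
  ∑-neg (suc n) f rewrite ∑-neg n (f ∘ suc) = sym (ℤ.neg-distrib-+ (f 0) _)

  ∑-last : ∀ n (f : ℕ → ℤ) → ∑ (suc n) f ≡ ∑ n f + f n
  ∑-last zero f = ℤ.+-comm (f 0) 0ℤ
  ∑-last (suc n) f rewrite ∑-last n (f ∘ suc) = sym (ℤ.+-assoc (f 0) _ (f (suc n)))

  ∑-single : ∀ n j (f : ℕ → ℤ) → j < n → (∀ i → i < n → i ≢ j → f i ≡ 0ℤ) → ∑ n f ≡ f j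
  ∑-single (suc n) zero f _ others = begin
    f 0 + ∑ n (f ∘ suc)  ≡⟨ cong (f 0 +_) (∑-zero n (f ∘ suc) (λ i i<n → others (suc i) (s≤s i<n) (λ ()))) ⟩
    f 0 + 0ℤ             ≡⟨ ℤ.+-identityʳ (f 0) ⟩
    f 0                  ∎
    where open ≡-Reasoning
  ∑-single (suc n) (suc j) f (s≤s j<n) others = begin
    f 0 + ∑ n (f ∘ suc)  ≡⟨ cong (_+ ∑ n (f ∘ suc)) (others 0 (s≤s z≤n) (λ ())) ⟩
    0ℤ + ∑ n (f ∘ suc)   ≡⟨ ℤ.+-identityˡ _ ⟩
    ∑ n (f ∘ suc)        ≡⟨ ∑-single n j (f ∘ suc) j<n (λ i i<n i≢j → others (suc i) (s≤s i<n) (i≢j ∘ ℕ.suc-injective)) ⟩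
    f (suc j)            ∎
    where open ≡-Reasoning

  ∑-reverse : ∀ n (f : ℕ → ℤ) → ∑ (suc n) f ≡ ∑[ i < suc n ] f (n ∸ i)
  ∑-reverse zero f = refl
  ∑-reverse (suc n) f = begin
    f 0 + ∑ (suc n) (f ∘ suc)                   ≡⟨ cong (f 0 +_) (∑-reverse n (f ∘ suc)) ⟩
    f 0 + ∑[ i < suc n ] f (suc (n ∸ i))        ≡⟨ cong (f 0 +_) (∑-cong (suc n) (λ i i≤n →
                                                     cong f (sym (ℕ.+-∸-assoc 1 (ℕ.≤-pred i≤n))))) ⟩
    f 0 + ∑[ i < suc n ] f (suc n ∸ i)          ≡⟨ ℤ.+-comm (f 0) _ ⟩
    ∑[ i < suc n ] f (suc n ∸ i) + f 0          ≡⟨ cong (λ m → ∑[ i < suc n ] f (suc n ∸ i) + f m) (sym (ℕ.n∸n≡0 n)) ⟩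
    ∑[ i < suc n ] f (suc n ∸ i) + f (n ∸ n)    ≡⟨ sym (∑-last (suc n) (λ i → f (suc n ∸ i))) ⟩
    ∑[ i < suc (suc n) ] f (suc n ∸ i)          ∎
    where open ≡-Reasoning

  ∑-swap : ∀ m n (t : ℕ → ℕ → ℤ) → ∑[ i < m ] ∑[ j < n ] t i j ≡ ∑[ j < n ] ∑[ i < m ] t i j
  ∑-swap zero n t = sym (∑-zero n _ (λ _ _ → refl))
  ∑-swap (suc m) n t = begin
    ∑ n (t 0) + ∑[ i < m ] ∑[ j < n ] t (suc i) j   ≡⟨ cong (∑ n (t 0) +_) (∑-swap m n (t ∘ suc)) ⟩
    ∑ n (t 0) + ∑[ j < n ] ∑[ i < m ] t (suc i) j   ≡⟨ sym (∑-+ n (t 0) _) ⟩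
    ∑[ j < n ] ∑[ i < suc m ] t i j                 ∎
    where open ≡-Reasoning

  ∑-triangle : ∀ n (t : ℕ → ℕ → ℤ) →
               ∑[ i < n ] ∑[ j < suc i ] t i j ≡ ∑[ j < n ] ∑[ k < n ∸ j ] t (j ℕ.+ k) j
  ∑-triangle zero t = refl
  ∑-triangle (suc n) t = begin
    (t 0 0 + 0ℤ) + ∑[ i < n ] (t (suc i) 0 + ∑[ j < suc i ] t (suc i) (suc j))
      ≡⟨ cong ((t 0 0 + 0ℤ) +_) (∑-+ n (λ i → t (suc i) 0) _) ⟩
    (t 0 0 + 0ℤ) + (∑[ i < n ] t (suc i) 0 + ∑[ i < n ] ∑[ j < suc i ] t (suc i) (suc j))
      ≡⟨ cong (λ s → (t 0 0 + 0ℤ) + (∑[ i < n ] t (suc i) 0 + s)) (∑-triangle n (λ i j → t (suc i) (suc j))) ⟩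
    (t 0 0 + 0ℤ) + (∑[ i < n ] t (suc i) 0 + ∑[ j < n ] ∑[ k < n ∸ j ] t (suc (j ℕ.+ k)) (suc j))
      ≡⟨ regroup (t 0 0) _ _ ⟩
    (t 0 0 + ∑[ k < n ] t (suc k) 0) + ∑[ j < n ] ∑[ k < n ∸ j ] t (suc (j ℕ.+ k)) (suc j)
      ∎
    where
    open ≡-Reasoning
    regroup : ∀ x y z → (x + 0ℤ) + (y + z) ≡ (x + y) + z
    regroup = solve-∀

  ∑-update : ∀ n j (f g : ℕ → ℤ) → j < n → (∀ i → i < n → i ≢ j → f i ≡ g i) → ∑ n f ≡ ∑ n g + (f j - g j)
  ∑-update n j f g j<n agree = begin
    ∑ n f                            ≡⟨ ∑-cong′ n (λ i → split (f i) (g i)) ⟩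
    ∑[ i < n ] (g i + (f i - g i))   ≡⟨ ∑-+ n g (λ i → f i - g i) ⟩
    ∑ n g + ∑[ i < n ] (f i - g i)   ≡⟨ cong (∑ n g +_) (∑-single n j (λ i → f i - g i) j<n λ i i<n i≢j →
                                          trans (cong (_- g i) (agree i i<n i≢j)) (ℤ.+-inverseʳ (g i))) ⟩
    ∑ n g + (f j - g j)              ∎
    where
    open ≡-Reasoning
    split : ∀ x y → x ≡ y + (x - y)
    split = solve-∀

module PowerSeries where

  open import Data.Nat as ℕ using (ℕ; zero; suc; _∸_; _≤_; _<_; s≤s)
  import Data.Nat.Properties as ℕ
  open import Data.Integer as ℤ using (ℤ; -_; _+_; _*_; 0ℤ; 1ℤ)
  import Data.Integer.Properties as ℤ
  open import Data.Maybe using (just; nothing)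
  open import Data.Product using (_,_)
  open import Data.Sum using (inj₁; inj₂)
  open import Level using (0ℓ)
  open import Algebra.Bundles using (CommutativeRing)
  import Algebra.Solver.Ring.AlmostCommutativeRing as ACR
  open import Relation.Binary.Definitions using (WeaklyDecidable)
  open import Relation.Binary.PropositionalEquality
  open import Relation.Nullary using (yes; no)
  import Relation.Binary.Reasoning.Setoid as SetoidReasoning
  open FiniteSums

  Series : Set
  Series = ℕ → ℤ

  infix 4 _≈_
  record _≈_ (f g : Series) : Set where
    constructor mk≈
    field at : ∀ n → f n ≡ g n
  open _≈_ public

  infixl 6 _⊕_
  infixl 7 _⊛_
  infix 8 ⊝_

  _⊕_ : Series → Series → Series
  (f ⊕ g) n = f n + g n

  ⊝_ : Series → Series
  (⊝ f) n = - f n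

  _⊛_ : Series → Series → Series
  (f ⊛ g) n = ∑[ i < suc n ] (f i * g (n ∸ i))

  const : ℤ → Series
  const k zero = k
  const k (suc _) = 0ℤ

  𝟘 : Series
  𝟘 _ = 0ℤ

  𝟙 : Series
  𝟙 = const 1ℤ

  ≈-refl : ∀ {f} → f ≈ f
  ≈-refl = mk≈ λ _ → refl

  ≈-sym : ∀ {f g} → f ≈ g → g ≈ f
  ≈-sym f≈g = mk≈ λ n → sym (at f≈g n)

  ≈-trans : ∀ {f g h} → f ≈ g → g ≈ h → f ≈ h
  ≈-trans f≈g g≈h = mk≈ λ n → trans (at f≈g n) (at g≈h n)

  ≡⇒≈ : ∀ {f g} → f ≡ g → f ≈ g
  ≡⇒≈ refl = ≈-refl

  ⊛-comm : ∀ f g → f ⊛ g ≈ g ⊛ f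
  ⊛-comm f g = mk≈ λ n → begin
    ∑[ i < suc n ] (f i * g (n ∸ i))                ≡⟨ ∑-reverse n (λ i → f i * g (n ∸ i)) ⟩
    ∑[ i < suc n ] (f (n ∸ i) * g (n ∸ (n ∸ i)))    ≡⟨ ∑-cong (suc n) (λ i i≤n → trans
                                                          (cong (λ k → f (n ∸ i) * g k) (ℕ.m∸[m∸n]≡n (ℕ.≤-pred i≤n)))
                                                          (ℤ.*-comm (f (n ∸ i)) (g i))) ⟩
    ∑[ i < suc n ] (g i * f (n ∸ i))                ∎
    where open ≡-Reasoning

  ⊛-assoc : ∀ f g h → (f ⊛ g) ⊛ h ≈ f ⊛ (g ⊛ h)
  ⊛-assoc f g h = mk≈ λ n → begin
    ∑[ i < suc n ] (∑[ j < suc i ] (f j * g (i ∸ j)) * h (n ∸ i))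
      ≡⟨ ∑-cong′ (suc n) (λ i → sym (∑-*ʳ (suc i) (h (n ∸ i)) (λ j → f j * g (i ∸ j)))) ⟩
    ∑[ i < suc n ] ∑[ j < suc i ] (f j * g (i ∸ j) * h (n ∸ i))
      ≡⟨ ∑-triangle (suc n) (λ i j → f j * g (i ∸ j) * h (n ∸ i)) ⟩
    ∑[ j < suc n ] ∑[ k < suc n ∸ j ] (f j * g ((j ℕ.+ k) ∸ j) * h (n ∸ (j ℕ.+ k)))
      ≡⟨ ∑-cong (suc n) (λ j j≤n → inner n j (ℕ.≤-pred j≤n)) ⟩
    ∑[ j < suc n ] (f j * ∑[ k < suc (n ∸ j) ] (g k * h ((n ∸ j) ∸ k)))
      ∎
    where
    open ≡-Reasoning
    inner : ∀ n j → j ≤ n →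
            ∑[ k < suc n ∸ j ] (f j * g ((j ℕ.+ k) ∸ j) * h (n ∸ (j ℕ.+ k)))
            ≡ f j * ∑[ k < suc (n ∸ j) ] (g k * h ((n ∸ j) ∸ k))
    inner n j j≤n rewrite ℕ.+-∸-assoc 1 j≤n = trans
      (∑-cong′ (suc (n ∸ j)) (λ k → trans
        (cong₂ (λ u v → f j * g u * h v) (ℕ.m+n∸m≡n j k) (sym (ℕ.∸-+-assoc n j k)))
        (ℤ.*-assoc (f j) (g k) (h ((n ∸ j) ∸ k)))))
      (∑-*ˡ (suc (n ∸ j)) (f j) (λ k → g k * h ((n ∸ j) ∸ k)))

  ⊛-distribˡ-⊕ : ∀ f g h → f ⊛ (g ⊕ h) ≈ f ⊛ g ⊕ f ⊛ h
  ⊛-distribˡ-⊕ f g h = mk≈ λ n → trans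
    (∑-cong′ (suc n) (λ i → ℤ.*-distribˡ-+ (f i) (g (n ∸ i)) (h (n ∸ i))))
    (∑-+ (suc n) (λ i → f i * g (n ∸ i)) (λ i → f i * h (n ∸ i)))

  ⊛-identityˡ : ∀ f → 𝟙 ⊛ f ≈ f
  ⊛-identityˡ f = mk≈ λ n →
    trans (cong₂ _+_ (ℤ.*-identityˡ (f n)) (∑-zero n _ (λ _ _ → refl))) (ℤ.+-identityʳ (f n))

  ⊛-cong : ∀ {f f′ g g′} → f ≈ f′ → g ≈ g′ → f ⊛ g ≈ f′ ⊛ g′
  ⊛-cong f≈f′ g≈g′ = mk≈ λ n → ∑-cong′ (suc n) (λ i → cong₂ _*_ (at f≈f′ i) (at g≈g′ (n ∸ i)))

  seriesRing : CommutativeRing 0ℓ 0ℓ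
  seriesRing = record
    { Carrier = Series ; _≈_ = _≈_ ; _+_ = _⊕_ ; _*_ = _⊛_ ; -_ = ⊝_ ; 0# = 𝟘 ; 1# = 𝟙
    ; isCommutativeRing = record
      { isRing = record
        { +-isAbelianGroup = record
          { isGroup = record
            { isMonoid = record
              { isSemigroup = record
                { isMagma = record
                  { isEquivalence = record { refl = ≈-refl ; sym = ≈-sym ; trans = ≈-trans }
                  ; ∙-cong = λ p q → mk≈ λ n → cong₂ _+_ (at p n) (at q n) }
                ; assoc = λ f g h → mk≈ λ n → ℤ.+-assoc (f n) (g n) (h n) }
              ; identity = (λ f → mk≈ λ n → ℤ.+-identityˡ (f n)) , (λ f → mk≈ λ n → ℤ.+-identityʳ (f n)) }
            ; inverse = (λ f → mk≈ λ n → ℤ.+-inverseˡ (f n)) , (λ f → mk≈ λ n → ℤ.+-inverseʳ (f n))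
            ; ⁻¹-cong = λ p → mk≈ λ n → cong -_ (at p n) }
          ; comm = λ f g → mk≈ λ n → ℤ.+-comm (f n) (g n) }
        ; *-cong = ⊛-cong
        ; *-assoc = ⊛-assoc
        ; *-identity = ⊛-identityˡ , (λ f → ≈-trans (⊛-comm f 𝟙) (⊛-identityˡ f))
        ; distrib = ⊛-distribˡ-⊕ , λ f g h → ≈-trans (⊛-comm (g ⊕ h) f)
                     (≈-trans (⊛-distribˡ-⊕ f g h) (⊕-cong (⊛-comm f g) (⊛-comm f h))) }
      ; *-comm = ⊛-comm } }
    where
    ⊕-cong : ∀ {f f′ g g′} → f ≈ f′ → g ≈ g′ → f ⊕ g ≈ f′ ⊕ g′
    ⊕-cong p q = mk≈ λ n → cong₂ _+_ (at p n) (at q n)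

  open CommutativeRing seriesRing public
    using (zeroˡ; zeroʳ)
    renaming ( +-cong to ⊕-cong; +-comm to ⊕-comm; +-assoc to ⊕-assoc
             ; +-identityˡ to ⊕-identityˡ; +-identityʳ to ⊕-identityʳ
             ; -‿cong to ⊝-cong; *-identityʳ to ⊛-identityʳ)

  ⊕-congˡ : ∀ f {g g′} → g ≈ g′ → f ⊕ g ≈ f ⊕ g′
  ⊕-congˡ f = ⊕-cong (≈-refl {f})

  ⊕-congʳ : ∀ g {f f′} → f ≈ f′ → f ⊕ g ≈ f′ ⊕ g
  ⊕-congʳ g f≈f′ = ⊕-cong f≈f′ (≈-refl {g})

  ⊛-congˡ : ∀ f {g g′} → g ≈ g′ → f ⊛ g ≈ f ⊛ g′
  ⊛-congˡ f = ⊛-cong (≈-refl {f})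

  ⊛-congʳ : ∀ g {f f′} → f ≈ f′ → f ⊛ g ≈ f′ ⊛ g
  ⊛-congʳ g f≈f′ = ⊛-cong f≈f′ (≈-refl {g})

  module ≈-Reasoning = SetoidReasoning (CommutativeRing.setoid seriesRing)

  const-* : ∀ i j → const (i * j) ≈ const i ⊛ const j
  const-* i j = mk≈ λ
    { zero → sym (ℤ.+-identityʳ (i * j))
    ; (suc n) → sym (cong₂ _+_ (ℤ.*-zeroʳ i) (∑-zero (suc n) _ (λ k _ → ℤ.*-zeroˡ (const j (n ∸ k))))) }

  constHom : ACR._-Raw-AlmostCommutative⟶_ (CommutativeRing.rawRing ℤ.+-*-commutativeRing)
                                         (ACR.fromCommutativeRing seriesRing)
  constHom = record
    { ⟦_⟧ = const
    ; +-homo = λ i j → mk≈ λ { zero → refl ; (suc n) → refl }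
    ; *-homo = const-*
    ; -‿homo = λ i → mk≈ λ { zero → refl ; (suc n) → refl }
    ; 0-homo = mk≈ λ { zero → refl ; (suc n) → refl }
    ; 1-homo = mk≈ λ { zero → refl ; (suc n) → refl } }

  const-≟ : WeaklyDecidable (ACR.Induced-equivalence constHom)
  const-≟ i j with i ℤ.≟ j
  ... | yes refl = just ≈-refl
  ... | no _ = nothing

  open import Algebra.Solver.Ring (CommutativeRing.rawRing ℤ.+-*-commutativeRing)
    (ACR.fromCommutativeRing seriesRing) constHom const-≟ public
    using (solve; _:=_; _:+_; _:*_; :-_; con)

  infix 9 q^_ 1-q^_

  q^_ : ℕ → Series
  q^ zero = 𝟙
  (q^ suc k) zero = 0ℤ
  (q^ suc k) (suc n) = (q^ k) n

  1-q^_ : ℕ → Series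
  1-q^ k = 𝟙 ⊕ ⊝ q^ k

  shift : ℕ → Series → Series
  shift zero f = f
  shift (suc k) f zero = 0ℤ
  shift (suc k) f (suc n) = shift k f n

  q^-⊛ : ∀ k f → q^ k ⊛ f ≈ shift k f
  q^-⊛ zero f = ⊛-identityˡ f
  q^-⊛ (suc k) f = mk≈ λ
    { zero → ℤ.*-zeroˡ (f 0)
    ; (suc n) → trans (cong (_+ (q^ k ⊛ f) n) (ℤ.*-zeroˡ (f (suc n))))
                      (trans (ℤ.+-identityˡ _) (at (q^-⊛ k f) n)) }

  shift-≥ : ∀ k f n → k ≤ n → shift k f n ≡ f (n ∸ k)
  shift-≥ zero f n _ = refl
  shift-≥ (suc k) f (suc n) (s≤s k≤n) = shift-≥ k f n k≤n

  shift-< : ∀ k f n → n < k → shift k f n ≡ 0ℤ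
  shift-< (suc k) f zero _ = refl
  shift-< (suc k) f (suc n) (s≤s n<k) = shift-< k f n n<k

  q^-+ : ∀ j k → q^ j ⊛ q^ k ≈ q^ (j ℕ.+ k)
  q^-+ j k = ≈-trans (q^-⊛ j (q^ k)) (shift-q^ j)
    where
    shift-q^ : ∀ j → shift j (q^ k) ≈ q^ (j ℕ.+ k)
    shift-q^ zero = ≈-refl
    shift-q^ (suc j) = mk≈ λ { zero → refl ; (suc n) → at (shift-q^ j) n }

  q^-< : ∀ k n → n < k → (q^ k) n ≡ 0ℤ
  q^-< (suc k) zero _ = refl
  q^-< (suc k) (suc n) (s≤s n<k) = q^-< k n n<k

  ∑ₛ : ℕ → (ℕ → Series) → Series
  ∑ₛ n F m = ∑[ j < n ] F j m

  syntax ∑ₛ n (λ j → e) = ∑ₛ[ j < n ] e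

  ∑ₛ-cong : ∀ n {F G : ℕ → Series} → (∀ j → j < n → F j ≈ G j) → ∑ₛ n F ≈ ∑ₛ n G
  ∑ₛ-cong n F≈G = mk≈ λ m → ∑-cong n (λ j j<n → at (F≈G j j<n) m)

  ∑ₛ-⊕ : ∀ n (F G : ℕ → Series) → ∑ₛ[ j < n ] (F j ⊕ G j) ≈ ∑ₛ n F ⊕ ∑ₛ n G
  ∑ₛ-⊕ n F G = mk≈ λ m → ∑-+ n (λ j → F j m) (λ j → G j m)

  ∑ₛ-⊝ : ∀ n (F : ℕ → Series) → ∑ₛ[ j < n ] (⊝ F j) ≈ ⊝ ∑ₛ n F
  ∑ₛ-⊝ n F = mk≈ λ m → ∑-neg n (λ j → F j m)

  ∑ₛ-last : ∀ n (F : ℕ → Series) → ∑ₛ (suc n) F ≈ ∑ₛ n F ⊕ F n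
  ∑ₛ-last n F = mk≈ λ m → ∑-last n (λ j → F j m)

  ⊛-∑ₛ : ∀ n g (F : ℕ → Series) → g ⊛ ∑ₛ n F ≈ ∑ₛ[ j < n ] (g ⊛ F j)
  ⊛-∑ₛ n g F = mk≈ λ m → trans
    (∑-cong′ (suc m) (λ i → sym (∑-*ˡ n (g i) (λ j → F j (m ∸ i)))))
    (∑-swap (suc m) n (λ i j → g i * F j (m ∸ i)))

  ∏ : (ℕ → Series) → ℕ → Series
  ∏ f zero = 𝟙
  ∏ f (suc n) = ∏ f n ⊛ f n

  infix 4 _≈[<_]_
  _≈[<_]_ : Series → ℕ → Series → Set
  f ≈[< e ] g = ∀ n → n < e → f n ≡ g n

  ≈⇒≈[<] : ∀ {f g e} → f ≈ g → f ≈[< e ] g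
  ≈⇒≈[<] f≈g n _ = at f≈g n

  ≈[<]-trans : ∀ {f g h e} → f ≈[< e ] g → g ≈[< e ] h → f ≈[< e ] h
  ≈[<]-trans f≈g g≈h n n<e = trans (f≈g n n<e) (g≈h n n<e)

  ≈[<]-weaken : ∀ {f g e e′} → e′ ≤ e → f ≈[< e ] g → f ≈[< e′ ] g
  ≈[<]-weaken e′≤e f≈g n n<e′ = f≈g n (ℕ.<-≤-trans n<e′ e′≤e)

  ⊛-cong-≈[<] : ∀ {f f′ g g′ e} → f ≈[< e ] f′ → g ≈[< e ] g′ → f ⊛ g ≈[< e ] f′ ⊛ g′
  ⊛-cong-≈[<] f≈f′ g≈g′ n n<e = ∑-cong (suc n) (λ i i≤n → cong₂ _*_
    (f≈f′ i (ℕ.≤-<-trans (ℕ.≤-pred i≤n) n<e))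
    (g≈g′ (n ∸ i) (ℕ.≤-<-trans (ℕ.m∸n≤m n i) n<e)))

  1-q^-≈[<]-𝟙 : ∀ k → 1-q^ k ≈[< k ] 𝟙
  1-q^-≈[<]-𝟙 k n n<k = trans (cong (λ c → 𝟙 n + - c) (q^-< k n n<k)) (ℤ.+-identityʳ (𝟙 n))

  ∏-≈[<]-prefix : ∀ (f : ℕ → Series) e j n → j ≤ n → (∀ i → j ≤ i → i < n → f i ≈[< e ] 𝟙) →
                  ∏ f n ≈[< e ] ∏ f j
  ∏-≈[<]-prefix f e j n j≤n tail≈𝟙 with ℕ.m≤n⇒m<n∨m≡n j≤n
  ... | inj₂ refl = λ _ _ → refl
  ∏-≈[<]-prefix f e j (suc n) _ tail≈𝟙 | inj₁ j<1+n = ≈[<]-trans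
    (⊛-cong-≈[<] (∏-≈[<]-prefix f e j n (ℕ.≤-pred j<1+n) (λ i j≤i i<n → tail≈𝟙 i j≤i (ℕ.m<n⇒m<1+n i<n)))
                 (tail≈𝟙 n (ℕ.≤-pred j<1+n) ℕ.≤-refl))
    (≈⇒≈[<] (⊛-identityʳ (∏ f j)))

  ⊝-𝟘 : ⊝ 𝟘 ≈ 𝟘
  ⊝-𝟘 = mk≈ λ _ → refl

  signed : ℕ → Series → Series
  signed zero f = f
  signed (suc k) f = ⊝ signed k f

  signed-cong : ∀ k {f g} → f ≈ g → signed k f ≈ signed k g
  signed-cong zero f≈g = f≈g
  signed-cong (suc k) f≈g = ⊝-cong (signed-cong k f≈g)

  signed-⊕ : ∀ k f g → signed k (f ⊕ g) ≈ signed k f ⊕ signed k g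
  signed-⊕ zero f g = ≈-refl
  signed-⊕ (suc k) f g = ≈-trans (⊝-cong (signed-⊕ k f g)) (mk≈ λ n → ℤ.neg-distrib-+ (signed k f n) (signed k g n))

  ⊛-signed : ∀ k g f → g ⊛ signed k f ≈ signed k (g ⊛ f)
  ⊛-signed zero g f = ≈-refl
  ⊛-signed (suc k) g f = ≈-trans (⊛-⊝ g (signed k f)) (⊝-cong (⊛-signed k g f))
    where
    ⊛-⊝ : ∀ P Q → P ⊛ (⊝ Q) ≈ ⊝ (P ⊛ Q)
    ⊛-⊝ = solve 2 (λ P Q → P :* (:- Q) := :- (P :* Q)) ≈-refl

  signed-𝟘 : ∀ k → signed k 𝟘 ≈ 𝟘
  signed-𝟘 zero = ≈-refl
  signed-𝟘 (suc k) = ≈-trans (⊝-cong (signed-𝟘 k)) ⊝-𝟘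

  signed-suc-suc : ∀ k f → signed (suc (suc k)) f ≈ signed k f
  signed-suc-suc k f = mk≈ λ n → ℤ.neg-involutive (signed k f n)

  ∑ₛ-drop-last : ∀ n (F : ℕ → Series) → F n ≈ 𝟘 → ∑ₛ (suc n) F ≈ ∑ₛ n F
  ∑ₛ-drop-last n F Fn≈𝟘 = ≈-trans (∑ₛ-last n F) (≈-trans (⊕-congˡ (∑ₛ n F) Fn≈𝟘) (⊕-identityʳ (∑ₛ n F)))

  ∑ₛ-drop-first : ∀ n (F : ℕ → Series) → F 0 ≈ 𝟘 → ∑ₛ (suc n) F ≈ ∑ₛ[ i < n ] F (suc i)
  ∑ₛ-drop-first n F F0≈𝟘 = ≈-trans (⊕-congʳ (∑ₛ[ i < n ] F (suc i)) F0≈𝟘) (⊕-identityˡ (∑ₛ[ i < n ] F (suc i)))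

  ∏-⊛ : ∀ (f g : ℕ → Series) n → ∏ f n ⊛ ∏ g n ≈ ∏ (λ i → f i ⊛ g i) n
  ∏-⊛ f g zero = ⊛-identityˡ 𝟙
  ∏-⊛ f g (suc n) = ≈-trans (interchange (∏ f n) (f n) (∏ g n) (g n)) (⊛-congʳ (f n ⊛ g n) (∏-⊛ f g n))
    where
    interchange : ∀ A B C D → (A ⊛ B) ⊛ (C ⊛ D) ≈ (A ⊛ C) ⊛ (B ⊛ D)
    interchange = solve 4 (λ A B C D → (A :* B) :* (C :* D) := (A :* C) :* (B :* D)) ≈-refl

  ∏-cong : ∀ {f g : ℕ → Series} n → (∀ i → i < n → f i ≈ g i) → ∏ f n ≈ ∏ g n
  ∏-cong zero _ = ≈-refl
  ∏-cong (suc n) f≈g = ⊛-cong (∏-cong n (λ i i<n → f≈g i (ℕ.m<n⇒m<1+n i<n))) (f≈g n ℕ.≤-refl)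

  ∏-+ : ∀ (f : ℕ → Series) n m → ∏ f (n ℕ.+ m) ≈ ∏ f n ⊛ ∏ (λ j → f (n ℕ.+ j)) m
  ∏-+ f n zero = ≈-trans (≡⇒≈ (cong (∏ f) (ℕ.+-identityʳ n))) (≈-sym (⊛-identityʳ (∏ f n)))
  ∏-+ f n (suc m) = begin
    ∏ f (n ℕ.+ suc m)                                          ≡⟨ cong (∏ f) (ℕ.+-suc n m) ⟩
    ∏ f (n ℕ.+ m) ⊛ f (n ℕ.+ m)                                ≈⟨ ⊛-congʳ (f (n ℕ.+ m)) (∏-+ f n m) ⟩
    (∏ f n ⊛ ∏ (λ j → f (n ℕ.+ j)) m) ⊛ f (n ℕ.+ m)            ≈⟨ ⊛-assoc (∏ f n) (∏ (λ j → f (n ℕ.+ j)) m) (f (n ℕ.+ m)) ⟩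
    ∏ f n ⊛ ∏ (λ j → f (n ℕ.+ j)) (suc m)                      ∎
    where open ≈-Reasoning

module GaussianBinomials where

  open import Data.Nat as ℕ using (ℕ; zero; suc; _∸_; _≤_; _<_; z≤n; s≤s)
  import Data.Nat.Properties as ℕ
  open import Data.Integer using (1ℤ)
  import Data.Integer.Properties as ℤ
  open import Data.Sum using (inj₁; inj₂)
  open import Relation.Binary.PropositionalEquality
  open PowerSeries

  module GaussianBinomial (a : ℕ) where

    infix 9 t^_ 1-t^_

    t^_ : ℕ → Series
    t^ k = q^ (k ℕ.* a)

    1-t^_ : ℕ → Series
    1-t^ k = 1-q^ (k ℕ.* a)

    t^-+ : ∀ i j → t^ i ⊛ t^ j ≈ t^ (i ℕ.+ j)
    t^-+ i j = ≈-trans (q^-+ (i ℕ.* a) (j ℕ.* a)) (≡⇒≈ (cong q^_ (sym (ℕ.*-distribʳ-+ a i j))))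

    gauss : ℕ → ℕ → Series
    gauss zero zero = 𝟙
    gauss zero (suc j) = 𝟘
    gauss (suc M) zero = 𝟙
    gauss (suc M) (suc j) = gauss M (suc j) ⊕ t^ (M ∸ j) ⊛ gauss M j

    gauss-zero : ∀ M → gauss M 0 ≈ 𝟙
    gauss-zero zero = ≈-refl
    gauss-zero (suc M) = ≈-refl

    gauss-> : ∀ M j → M < j → gauss M j ≈ 𝟘
    gauss-> zero (suc j) _ = ≈-refl
    gauss-> (suc M) (suc j) (s≤s M<j) = begin
      gauss M (suc j) ⊕ t^ (M ∸ j) ⊛ gauss M j  ≈⟨ ⊕-cong (gauss-> M (suc j) (ℕ.m<n⇒m<1+n M<j))
                                                            (⊛-congˡ (t^ (M ∸ j)) (gauss-> M j M<j)) ⟩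
      𝟘 ⊕ t^ (M ∸ j) ⊛ 𝟘                         ≈⟨ ≈-trans (⊕-identityˡ (t^ (M ∸ j) ⊛ 𝟘)) (zeroʳ (t^ (M ∸ j))) ⟩
      𝟘                                          ∎
      where open ≈-Reasoning

    1-t^0 : 1-t^ 0 ≈ 𝟘
    1-t^0 = mk≈ λ n → ℤ.+-inverseʳ (𝟙 n)

    gauss-ratio-≥ : ∀ M j → M ≤ j → 1-t^ suc j ⊛ gauss M (suc j) ≈ 1-t^ (M ∸ j) ⊛ gauss M j
    gauss-ratio-≥ M j M≤j = ≈-trans (≈-trans (⊛-congˡ (1-t^ suc j) (gauss-> M (suc j) (s≤s M≤j))) (zeroʳ (1-t^ suc j))) (≈-sym rhs≈𝟘)
      where
      rhs≈𝟘 : 1-t^ (M ∸ j) ⊛ gauss M j ≈ 𝟘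
      rhs≈𝟘 with ℕ.m≤n⇒m<n∨m≡n M≤j
      ... | inj₁ M<j = ≈-trans (⊛-congˡ (1-t^ (M ∸ j)) (gauss-> M j M<j)) (zeroʳ (1-t^ (M ∸ j)))
      ... | inj₂ refl = ≈-trans (⊛-congʳ (gauss M M) (≈-trans (≡⇒≈ (cong 1-t^_ (ℕ.n∸n≡0 M))) 1-t^0)) (zeroˡ (gauss M M))

    private
      distrib-⊛ : ∀ P Q R S → P ⊛ (Q ⊕ R ⊛ S) ≈ P ⊛ Q ⊕ P ⊛ R ⊛ S
      distrib-⊛ = solve 4 (λ P Q R S → P :* (Q :+ R :* S) := P :* Q :+ P :* R :* S) ≈-refl

      absorb : ∀ P Q S → (𝟙 ⊕ ⊝ P) ⊛ S ⊕ (𝟙 ⊕ ⊝ Q) ⊛ P ⊛ S ≈ (𝟙 ⊕ ⊝ (Q ⊛ P)) ⊛ S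
      absorb = solve 3 (λ P Q S → (con 1ℤ :+ :- P) :* S :+ (con 1ℤ :+ :- Q) :* P :* S
                                  := (con 1ℤ :+ :- (Q :* P)) :* S) ≈-refl

      rotate : ∀ P Q S → P ⊛ Q ⊛ S ≈ Q ⊛ (P ⊛ S)
      rotate = solve 3 (λ P Q S → P :* Q :* S := Q :* (P :* S)) ≈-refl

      collect : ∀ P Q R S → P ⊛ Q ⊕ R ⊛ (P ⊛ S) ≈ P ⊛ (Q ⊕ R ⊛ S)
      collect = solve 4 (λ P Q R S → P :* Q :+ R :* (P :* S) := P :* (Q :+ R :* S)) ≈-refl

    gauss-ratio : ∀ M j → 1-t^ suc j ⊛ gauss M (suc j) ≈ 1-t^ (M ∸ j) ⊛ gauss M j
    gauss-ratio M j with ℕ.≤-<-connex M j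
    ... | inj₁ M≤j = gauss-ratio-≥ M j M≤j
    gauss-ratio (suc M) zero | inj₂ _ = begin
      1-t^ 1 ⊛ (W ⊕ t^ M ⊛ Z)              ≈⟨ distrib-⊛ (1-t^ 1) W (t^ M) Z ⟩
      1-t^ 1 ⊛ W ⊕ 1-t^ 1 ⊛ t^ M ⊛ Z       ≈⟨ ⊕-congʳ (1-t^ 1 ⊛ t^ M ⊛ Z) (gauss-ratio M 0) ⟩
      1-t^ M ⊛ Z ⊕ 1-t^ 1 ⊛ t^ M ⊛ Z       ≈⟨ absorb (t^ M) (t^ 1) Z ⟩
      (𝟙 ⊕ ⊝ (t^ 1 ⊛ t^ M)) ⊛ Z           ≈⟨ ⊛-cong (⊕-congˡ 𝟙 (⊝-cong (t^-+ 1 M))) (gauss-zero M) ⟩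
      1-t^ suc M ⊛ 𝟙                       ∎
      where
      open ≈-Reasoning
      W : Series
      W = gauss M 1
      Z : Series
      Z = gauss M 0
    gauss-ratio (suc M) (suc j) | inj₂ (s≤s j<M) = begin
      1-t^ suc (suc j) ⊛ (W ⊕ t^ u ⊛ Y)                    ≈⟨ distrib-⊛ (1-t^ suc (suc j)) W (t^ u) Y ⟩
      1-t^ suc (suc j) ⊛ W ⊕ 1-t^ suc (suc j) ⊛ t^ u ⊛ Y   ≈⟨ ⊕-congʳ (1-t^ suc (suc j) ⊛ t^ u ⊛ Y) (gauss-ratio M (suc j)) ⟩
      1-t^ u ⊛ Y ⊕ 1-t^ suc (suc j) ⊛ t^ u ⊛ Y             ≈⟨ absorb (t^ u) (t^ suc (suc j)) Y ⟩
      (𝟙 ⊕ ⊝ (t^ suc (suc j) ⊛ t^ u)) ⊛ Y                  ≈⟨ ⊛-congʳ Y (⊕-congˡ 𝟙 (⊝-cong exponents)) ⟩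
      (𝟙 ⊕ ⊝ (t^ suc j ⊛ t^ (M ∸ j))) ⊛ Y                  ≈⟨ absorb (t^ (M ∸ j)) (t^ suc j) Y ⟨
      1-t^ (M ∸ j) ⊛ Y ⊕ 1-t^ suc j ⊛ t^ (M ∸ j) ⊛ Y       ≈⟨ ⊕-congˡ (1-t^ (M ∸ j) ⊛ Y) (rotate (1-t^ suc j) (t^ (M ∸ j)) Y) ⟩
      1-t^ (M ∸ j) ⊛ Y ⊕ t^ (M ∸ j) ⊛ (1-t^ suc j ⊛ Y)     ≈⟨ ⊕-congˡ (1-t^ (M ∸ j) ⊛ Y) (⊛-congˡ (t^ (M ∸ j)) (gauss-ratio M j)) ⟩
      1-t^ (M ∸ j) ⊛ Y ⊕ t^ (M ∸ j) ⊛ (1-t^ (M ∸ j) ⊛ Z)  ≈⟨ collect (1-t^ (M ∸ j)) Y (t^ (M ∸ j)) Z ⟩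
      1-t^ (M ∸ j) ⊛ (Y ⊕ t^ (M ∸ j) ⊛ Z)                  ∎
      where
      open ≈-Reasoning
      u : ℕ
      u = M ∸ suc j
      W : Series
      W = gauss M (suc (suc j))
      Y : Series
      Y = gauss M (suc j)
      Z : Series
      Z = gauss M j
      exponents : t^ suc (suc j) ⊛ t^ u ≈ t^ suc j ⊛ t^ (M ∸ j)
      exponents = begin
        t^ suc (suc j) ⊛ t^ u     ≈⟨ t^-+ (suc (suc j)) u ⟩
        t^ (suc (suc j) ℕ.+ u)    ≡⟨ cong t^_ (trans (cong (λ k → suc (j ℕ.+ k)) (ℕ.+-∸-assoc 1 j<M)) (cong suc (ℕ.+-suc j u))) ⟨
        t^ (suc j ℕ.+ (M ∸ j))    ≈⟨ t^-+ (suc j) (M ∸ j) ⟨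
        t^ suc j ⊛ t^ (M ∸ j)     ∎

    gauss-pascal′ : ∀ M j → gauss (suc M) (suc j) ≈ t^ suc j ⊛ gauss M (suc j) ⊕ gauss M j
    gauss-pascal′ M j = rearrange (gauss M (suc j)) (gauss M j) (t^ suc j) (t^ (M ∸ j)) (gauss-ratio M j)
      where
      rearrange : ∀ Y Z P Q → (𝟙 ⊕ ⊝ P) ⊛ Y ≈ (𝟙 ⊕ ⊝ Q) ⊛ Z → Y ⊕ Q ⊛ Z ≈ P ⊛ Y ⊕ Z
      rearrange Y Z P Q ratio = begin
        Y ⊕ Q ⊛ Z                                                         ≈⟨ expand Y Z P Q ⟩
        (P ⊛ Y ⊕ Z) ⊕ ((𝟙 ⊕ ⊝ P) ⊛ Y ⊕ ⊝ ((𝟙 ⊕ ⊝ Q) ⊛ Z))             ≈⟨ ⊕-congˡ (P ⊛ Y ⊕ Z) (⊕-congʳ (⊝ ((𝟙 ⊕ ⊝ Q) ⊛ Z)) ratio) ⟩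
        (P ⊛ Y ⊕ Z) ⊕ ((𝟙 ⊕ ⊝ Q) ⊛ Z ⊕ ⊝ ((𝟙 ⊕ ⊝ Q) ⊛ Z))             ≈⟨ cancel (P ⊛ Y ⊕ Z) ((𝟙 ⊕ ⊝ Q) ⊛ Z) ⟩
        P ⊛ Y ⊕ Z                                                         ∎
        where
        open ≈-Reasoning
        expand : ∀ Y Z P Q → Y ⊕ Q ⊛ Z ≈ (P ⊛ Y ⊕ Z) ⊕ ((𝟙 ⊕ ⊝ P) ⊛ Y ⊕ ⊝ ((𝟙 ⊕ ⊝ Q) ⊛ Z))
        expand = solve 4 (λ Y Z P Q → Y :+ Q :* Z
                   := (P :* Y :+ Z) :+ ((con 1ℤ :+ :- P) :* Y :+ :- ((con 1ℤ :+ :- Q) :* Z))) ≈-refl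
        cancel : ∀ A R → A ⊕ (R ⊕ ⊝ R) ≈ A
        cancel = solve 2 (λ A R → A :+ (R :+ :- R) := A) ≈-refl

    gaussBelow : ℕ → ℕ → Series
    gaussBelow M zero = 𝟘
    gaussBelow M (suc j) = gauss M j

    gauss-suc : ∀ M j → gauss (suc M) j ≈ t^ j ⊛ gauss M j ⊕ gaussBelow M j
    gauss-suc M zero = ≈-sym (≈-trans (⊕-identityʳ (t^ 0 ⊛ gauss M 0)) (≈-trans (⊛-identityˡ (gauss M 0)) (gauss-zero M)))
    gauss-suc M (suc j) = gauss-pascal′ M j

    gauss-diagonal : ∀ M → gauss M M ≈ 𝟙
    gauss-diagonal zero = ≈-refl
    gauss-diagonal (suc M) = begin
      gauss M (suc M) ⊕ t^ (M ∸ M) ⊛ gauss M M  ≈⟨ ⊕-cong (gauss-> M (suc M) ℕ.≤-refl)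
                                                          (⊛-cong (≡⇒≈ (cong t^_ (ℕ.n∸n≡0 M))) (gauss-diagonal M)) ⟩
      𝟘 ⊕ 𝟙 ⊛ 𝟙                                  ≈⟨ ≈-trans (⊕-identityˡ (𝟙 ⊛ 𝟙)) (⊛-identityˡ 𝟙) ⟩
      𝟙                                          ∎
      where open ≈-Reasoning

    gauss-sym : ∀ M j → j ≤ M → gauss M j ≈ gauss M (M ∸ j)
    gauss-sym M zero _ = ≈-trans (gauss-zero M) (≈-sym (gauss-diagonal M))
    gauss-sym (suc M) (suc j) (s≤s j≤M) with ℕ.m≤n⇒m<n∨m≡n j≤M
    ... | inj₂ refl = ≈-trans (gauss-diagonal (suc j)) (≈-sym (≡⇒≈ (cong (gauss (suc j)) (ℕ.n∸n≡0 j))))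
    ... | inj₁ j<M = begin
      gauss M (suc j) ⊕ t^ (M ∸ j) ⊛ gauss M j   ≈⟨ ⊕-cong (gauss-sym M (suc j) j<M) (⊛-congˡ (t^ (M ∸ j)) (gauss-sym M j j≤M)) ⟩
      gauss M u ⊕ t^ (M ∸ j) ⊛ gauss M (M ∸ j)   ≡⟨ cong (λ k → gauss M u ⊕ t^ k ⊛ gauss M k) M∸j≡1+u ⟩
      gauss M u ⊕ t^ suc u ⊛ gauss M (suc u)     ≈⟨ ⊕-comm (gauss M u) (t^ suc u ⊛ gauss M (suc u)) ⟩
      t^ suc u ⊛ gauss M (suc u) ⊕ gauss M u     ≈⟨ gauss-pascal′ M u ⟨
      gauss (suc M) (suc u)                      ≡⟨ cong (gauss (suc M)) M∸j≡1+u ⟨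
      gauss (suc M) (M ∸ j)                      ∎
      where
      open ≈-Reasoning
      u : ℕ
      u = M ∸ suc j
      M∸j≡1+u : M ∸ j ≡ suc u
      M∸j≡1+u = ℕ.+-∸-assoc 1 j<M

    tPoch : ℕ → Series
    tPoch = ∏ (λ i → 1-t^ suc i)

    tPochDown : ℕ → ℕ → Series
    tPochDown M = ∏ (λ i → 1-t^ (M ∸ i))

    gauss-product : ∀ M j → tPoch j ⊛ gauss M j ≈ tPochDown M j
    gauss-product M zero = ≈-trans (⊛-identityˡ (gauss M 0)) (gauss-zero M)
    gauss-product M (suc j) = begin
      (tPoch j ⊛ 1-t^ suc j) ⊛ gauss M (suc j)    ≈⟨ ⊛-assoc (tPoch j) (1-t^ suc j) (gauss M (suc j)) ⟩
      tPoch j ⊛ (1-t^ suc j ⊛ gauss M (suc j))    ≈⟨ ⊛-congˡ (tPoch j) (gauss-ratio M j) ⟩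
      tPoch j ⊛ (1-t^ (M ∸ j) ⊛ gauss M j)        ≈⟨ exchange (tPoch j) (1-t^ (M ∸ j)) (gauss M j) ⟩
      (tPoch j ⊛ gauss M j) ⊛ 1-t^ (M ∸ j)        ≈⟨ ⊛-congʳ (1-t^ (M ∸ j)) (gauss-product M j) ⟩
      tPochDown M j ⊛ 1-t^ (M ∸ j)                ∎
      where
      open ≈-Reasoning
      exchange : ∀ P Q R → P ⊛ (Q ⊛ R) ≈ (P ⊛ R) ⊛ Q
      exchange = solve 3 (λ P Q R → P :* (Q :* R) := (P :* R) :* Q) ≈-refl

    module Truncated .⦃ _ : ℕ.NonZero a ⦄ where

      1-t^-≈[<]-𝟙 : ∀ k e → e ≤ k → 1-t^ k ≈[< e ] 𝟙
      1-t^-≈[<]-𝟙 k e e≤k = ≈[<]-weaken (ℕ.≤-trans e≤k (ℕ.m≤m*n k a)) (1-q^-≈[<]-𝟙 (k ℕ.* a))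

      tPochDown-≈[<]-𝟙 : ∀ M j → j ≤ M → tPochDown M j ≈[< suc (M ∸ j) ] 𝟙
      tPochDown-≈[<]-𝟙 M j j≤M = ∏-≈[<]-prefix (λ i → 1-t^ (M ∸ i)) (suc (M ∸ j)) 0 j z≤n
        (λ i _ i<j → 1-t^-≈[<]-𝟙 (M ∸ i) (suc (M ∸ j)) (ℕ.∸-monoʳ-< i<j j≤M))

      tPoch-≈[<]-prefix : ∀ j N → j ≤ N → tPoch N ≈[< suc j ] tPoch j
      tPoch-≈[<]-prefix j N j≤N = ∏-≈[<]-prefix (λ i → 1-t^ suc i) (suc j) j N j≤N
        (λ i j≤i _ → 1-t^-≈[<]-𝟙 (suc i) (suc j) (s≤s j≤i))

      tPoch-gauss-≈[<]-𝟙 : ∀ N j → j ≤ N → tPoch N ⊛ gauss (N ℕ.+ N) j ≈[< suc j ] 𝟙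
      tPoch-gauss-≈[<]-𝟙 N j j≤N = ≈[<]-trans
        (⊛-cong-≈[<] (tPoch-≈[<]-prefix j N j≤N) (λ _ _ → refl))
        (≈[<]-trans (≈⇒≈[<] (gauss-product (N ℕ.+ N) j))
                    (≈[<]-weaken (s≤s j≤2N∸j) (tPochDown-≈[<]-𝟙 (N ℕ.+ N) j (ℕ.≤-trans j≤N (ℕ.m≤m+n N N)))))
        where
        j≤2N∸j : j ≤ (N ℕ.+ N) ∸ j
        j≤2N∸j = ℕ.≤-trans j≤N (subst (_≤ (N ℕ.+ N) ∸ j) (ℕ.m+n∸n≡m N N) (ℕ.∸-monoʳ-≤ (N ℕ.+ N) j≤N))

module TripleProduct where

  open import Data.Nat as ℕ using (ℕ; zero; suc; _∸_; _≤_; _<_; s≤s)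
  import Data.Nat.Properties as ℕ
  open import Data.Nat.Tactic.RingSolver using (solve-∀)
  open import Data.Integer.Tactic.RingSolver using () renaming (solve-∀ to ℤsolve-∀)
  open import Data.Integer as ℤ using (ℤ; -_; 0ℤ; 1ℤ)
  import Data.Integer.Properties as ℤ
  open import Data.Empty using (⊥-elim)
  open import Data.Sum using (_⊎_; inj₁; inj₂)
  open import Data.Product using (_×_; _,_)
  open import Relation.Binary.Definitions using (tri<; tri≈; tri>)
  open import Relation.Binary.PropositionalEquality
  open import Relation.Nullary using (¬_; yes; no)
  open import Function using (_∘_)
  open import Defs using (signPow)
  open FiniteSums
  open PowerSeries
  open GaussianBinomials

  module Increasing (f : ℕ → ℕ) (f-< : ∀ m → f m < f (suc m)) where

    <-mono : ∀ {m n} → m < n → f m < f n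
    <-mono {m} {suc n} (s≤s m≤n) with ℕ.m≤n⇒m<n∨m≡n m≤n
    ... | inj₁ m<n = ℕ.<-trans (<-mono m<n) (f-< n)
    ... | inj₂ refl = f-< m

    ≤-mono : ∀ {m n} → m ≤ n → f m ≤ f n
    ≤-mono m≤n with ℕ.m≤n⇒m<n∨m≡n m≤n
    ... | inj₁ m<n = ℕ.<⇒≤ (<-mono m<n)
    ... | inj₂ refl = ℕ.≤-refl

    injective : ∀ {m n} → f m ≡ f n → m ≡ n
    injective {m} {n} fm≡fn with ℕ.<-cmp m n
    ... | tri< m<n _ _ = ⊥-elim (ℕ.<-irrefl fm≡fn (<-mono m<n))
    ... | tri≈ _ m≡n _ = m≡n
    ... | tri> _ _ n<m = ⊥-elim (ℕ.<-irrefl (sym fm≡fn) (<-mono n<m))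

  signPow-+ : ∀ p q → signPow (p ℕ.+ q) ≡ signPow p ℤ.* signPow q
  signPow-+ zero q = sym (ℤ.*-identityˡ (signPow q))
  signPow-+ (suc p) q = trans (cong -_ (signPow-+ p q)) (ℤ.neg-distribˡ-* (signPow p) (signPow q))

  signPow-square : ∀ m → signPow m ℤ.* signPow m ≡ 1ℤ
  signPow-square zero = refl
  signPow-square (suc m) = trans (neg-square (signPow m)) (signPow-square m)
    where
    neg-square : ∀ z → (- z) ℤ.* (- z) ≡ z ℤ.* z
    neg-square = ℤsolve-∀

  signPow-parity : ∀ k m n → k ℕ.+ m ≡ n ℕ.+ n → signPow k ≡ signPow m
  signPow-parity k m n k+m≡n+n = begin
    signPow k                                    ≡⟨ ℤ.*-identityʳ (signPow k) ⟨
    signPow k ℤ.* 1ℤ                             ≡⟨ cong (signPow k ℤ.*_) (signPow-square m) ⟨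
    signPow k ℤ.* (signPow m ℤ.* signPow m)      ≡⟨ ℤ.*-assoc (signPow k) (signPow m) (signPow m) ⟨
    signPow k ℤ.* signPow m ℤ.* signPow m        ≡⟨ cong (ℤ._* signPow m) (signPow-+ k m) ⟨
    signPow (k ℕ.+ m) ℤ.* signPow m              ≡⟨ cong (λ x → signPow x ℤ.* signPow m) k+m≡n+n ⟩
    signPow (n ℕ.+ n) ℤ.* signPow m              ≡⟨ cong (ℤ._* signPow m) (trans (signPow-+ n n) (signPow-square n)) ⟩
    1ℤ ℤ.* signPow m                             ≡⟨ ℤ.*-identityˡ (signPow m) ⟩
    signPow m                                    ∎
    where open ≡-Reasoning

  module FiniteJacobi (b c : ℕ) where

    open GaussianBinomial (b ℕ.+ c) public

    private
      a : ℕ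
      a = b ℕ.+ c

    triangle : ℕ → ℕ
    triangle zero = 0
    triangle (suc m) = triangle m ℕ.+ m

    -- eP k = b k + a k(k-1)/2 and eN k = c k + a k(k-1)/2 = eP (-k) are the exponents of Jacobi's theta
    -- series Σ_{k ∈ ℤ} (-1)^k q^(b k + a k(k-1)/2); E j N′ is this exponent at k = j - N′.
    eP eN : ℕ → ℕ
    eP m = m ℕ.* b ℕ.+ triangle m ℕ.* a
    eN m = m ℕ.* c ℕ.+ triangle m ℕ.* a

    E : ℕ → ℕ → ℕ
    E j N′ = eP (j ∸ N′) ℕ.+ eN (N′ ∸ j)

    E-above : ∀ N′ m → E (N′ ℕ.+ m) N′ ≡ eP m
    E-above N′ m = trans (cong₂ (λ u v → eP u ℕ.+ eN v) (ℕ.m+n∸m≡n N′ m) (ℕ.m≤n⇒m∸n≡0 (ℕ.m≤m+n N′ m))) (ℕ.+-identityʳ (eP m))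

    E-below : ∀ j m → E j (j ℕ.+ m) ≡ eN m
    E-below j m = trans (cong₂ (λ u v → eP u ℕ.+ eN v) (ℕ.m≤n⇒m∸n≡0 (ℕ.m≤m+n j m)) (ℕ.m+n∸m≡n j m)) (ℕ.+-identityˡ (eN m))

    E-≥ : ∀ {j N} → N ≤ j → E j N ≡ eP (j ∸ N)
    E-≥ {j} {N} N≤j = trans (cong (λ k → eP (j ∸ N) ℕ.+ eN k) (ℕ.m≤n⇒m∸n≡0 N≤j)) (ℕ.+-identityʳ _)

    E-< : ∀ {j N} → j < N → E j N ≡ eN (N ∸ j)
    E-< {j} {N} j<N = cong (λ k → eP k ℕ.+ eN (N ∸ j)) (ℕ.m≤n⇒m∸n≡0 (ℕ.<⇒≤ j<N))

    eP-suc : ∀ m → eP (suc m) ≡ eP m ℕ.+ (b ℕ.+ m ℕ.* a)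
    eP-suc m = step m (triangle m) b c
      where
      step : ∀ m T b c → suc m ℕ.* b ℕ.+ (T ℕ.+ m) ℕ.* (b ℕ.+ c) ≡ m ℕ.* b ℕ.+ T ℕ.* (b ℕ.+ c) ℕ.+ (b ℕ.+ m ℕ.* (b ℕ.+ c))
      step = solve-∀

    eN-suc : ∀ m → eN (suc m) ≡ eN m ℕ.+ (c ℕ.+ m ℕ.* a)
    eN-suc m = step m (triangle m) b c
      where
      step : ∀ m T b c → suc m ℕ.* c ℕ.+ (T ℕ.+ m) ℕ.* (b ℕ.+ c) ≡ m ℕ.* c ℕ.+ T ℕ.* (b ℕ.+ c) ℕ.+ (c ℕ.+ m ℕ.* (b ℕ.+ c))
      step = solve-∀

    E-step-N : ∀ N N′ i → i ≤ N ℕ.+ N′ → E (suc i) N′ ℕ.+ ((N ℕ.+ N′) ∸ i) ℕ.* a ≡ E i N′ ℕ.+ (b ℕ.+ N ℕ.* a)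
    E-step-N N N′ i i≤N+N′ with ℕ.≤-<-connex N′ i
    ... | inj₁ N′≤i = from-above N′ (i ∸ N′) (N ∸ (i ∸ N′)) (ℕ.m+[n∸m]≡n N′≤i) (ℕ.m+[n∸m]≡n i∸N′≤N)
      where
      i∸N′≤N : i ∸ N′ ≤ N
      i∸N′≤N = subst (i ∸ N′ ≤_) (ℕ.m+n∸n≡m N N′) (ℕ.∸-monoˡ-≤ N′ i≤N+N′)
      from-above : ∀ N′ m k {i N} → N′ ℕ.+ m ≡ i → m ℕ.+ k ≡ N →
                   E (suc i) N′ ℕ.+ ((N ℕ.+ N′) ∸ i) ℕ.* a ≡ E i N′ ℕ.+ (b ℕ.+ N ℕ.* a)
      from-above N′ m k refl refl = begin
        E (suc (N′ ℕ.+ m)) N′ ℕ.+ ((m ℕ.+ k ℕ.+ N′) ∸ (N′ ℕ.+ m)) ℕ.* a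
          ≡⟨ cong₂ (λ u v → u ℕ.+ v ℕ.* a) (trans (cong (λ x → E x N′) (sym (ℕ.+-suc N′ m))) (E-above N′ (suc m)))
                                            (trans (cong (_∸ (N′ ℕ.+ m)) (reorder m k N′)) (ℕ.m+n∸m≡n (N′ ℕ.+ m) k)) ⟩
        eP (suc m) ℕ.+ k ℕ.* a                     ≡⟨ cong (ℕ._+ k ℕ.* a) (eP-suc m) ⟩
        eP m ℕ.+ (b ℕ.+ m ℕ.* a) ℕ.+ k ℕ.* a       ≡⟨ arith (eP m) b c m k ⟩
        eP m ℕ.+ (b ℕ.+ (m ℕ.+ k) ℕ.* a)           ≡⟨ cong (ℕ._+ (b ℕ.+ (m ℕ.+ k) ℕ.* a)) (E-above N′ m) ⟨
        E (N′ ℕ.+ m) N′ ℕ.+ (b ℕ.+ (m ℕ.+ k) ℕ.* a) ∎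
        where
        open ≡-Reasoning
        reorder : ∀ m k N′ → m ℕ.+ k ℕ.+ N′ ≡ N′ ℕ.+ m ℕ.+ k
        reorder = solve-∀
        arith : ∀ e b c m k → e ℕ.+ (b ℕ.+ m ℕ.* (b ℕ.+ c)) ℕ.+ k ℕ.* (b ℕ.+ c) ≡ e ℕ.+ (b ℕ.+ (m ℕ.+ k) ℕ.* (b ℕ.+ c))
        arith = solve-∀
    ... | inj₂ i<N′ = from-below i (N′ ∸ suc i) (ℕ.m+[n∸m]≡n i<N′)
      where
      from-below : ∀ i k {N′} → suc i ℕ.+ k ≡ N′ →
                   E (suc i) N′ ℕ.+ ((N ℕ.+ N′) ∸ i) ℕ.* a ≡ E i N′ ℕ.+ (b ℕ.+ N ℕ.* a)
      from-below i k refl = begin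
        E (suc i) (suc i ℕ.+ k) ℕ.+ ((N ℕ.+ suc (i ℕ.+ k)) ∸ i) ℕ.* a
          ≡⟨ cong₂ (λ u v → u ℕ.+ v ℕ.* a) (E-below (suc i) k)
                                            (trans (cong (_∸ i) (reorder N i k)) (ℕ.m+n∸m≡n i (N ℕ.+ suc k))) ⟩
        eN k ℕ.+ (N ℕ.+ suc k) ℕ.* a
          ≡⟨ arith (eN k) b c N k ⟩
        eN k ℕ.+ (c ℕ.+ k ℕ.* a) ℕ.+ (b ℕ.+ N ℕ.* a)
          ≡⟨ cong (ℕ._+ (b ℕ.+ N ℕ.* a)) (eN-suc k) ⟨
        eN (suc k) ℕ.+ (b ℕ.+ N ℕ.* a)
          ≡⟨ cong (ℕ._+ (b ℕ.+ N ℕ.* a)) (trans (cong (E i) (sym (ℕ.+-suc i k))) (E-below i (suc k))) ⟨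
        E i (suc i ℕ.+ k) ℕ.+ (b ℕ.+ N ℕ.* a)
          ∎
        where
        open ≡-Reasoning
        reorder : ∀ N i k → N ℕ.+ suc (i ℕ.+ k) ≡ i ℕ.+ (N ℕ.+ suc k)
        reorder = solve-∀
        arith : ∀ e b c N k → e ℕ.+ (N ℕ.+ suc k) ℕ.* (b ℕ.+ c) ≡ e ℕ.+ (c ℕ.+ k ℕ.* (b ℕ.+ c)) ℕ.+ (b ℕ.+ N ℕ.* (b ℕ.+ c))
        arith = solve-∀

    E-step-N′ : ∀ N′ j → E j (suc N′) ℕ.+ j ℕ.* a ≡ E j N′ ℕ.+ (c ℕ.+ N′ ℕ.* a)
    E-step-N′ N′ j with ℕ.≤-<-connex j N′
    ... | inj₁ j≤N′ = from-below j (N′ ∸ j) (ℕ.m+[n∸m]≡n j≤N′)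
      where
      from-below : ∀ j k {N′} → j ℕ.+ k ≡ N′ → E j (suc N′) ℕ.+ j ℕ.* a ≡ E j N′ ℕ.+ (c ℕ.+ N′ ℕ.* a)
      from-below j k refl = begin
        E j (suc (j ℕ.+ k)) ℕ.+ j ℕ.* a
          ≡⟨ cong (ℕ._+ j ℕ.* a) (trans (cong (E j) (sym (ℕ.+-suc j k))) (E-below j (suc k))) ⟩
        eN (suc k) ℕ.+ j ℕ.* a
          ≡⟨ cong (ℕ._+ j ℕ.* a) (eN-suc k) ⟩
        eN k ℕ.+ (c ℕ.+ k ℕ.* a) ℕ.+ j ℕ.* a
          ≡⟨ arith (eN k) b c j k ⟩
        eN k ℕ.+ (c ℕ.+ (j ℕ.+ k) ℕ.* a)
          ≡⟨ cong (ℕ._+ (c ℕ.+ (j ℕ.+ k) ℕ.* a)) (E-below j k) ⟨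
        E j (j ℕ.+ k) ℕ.+ (c ℕ.+ (j ℕ.+ k) ℕ.* a)
          ∎
        where
        open ≡-Reasoning
        arith : ∀ e b c j k → e ℕ.+ (c ℕ.+ k ℕ.* (b ℕ.+ c)) ℕ.+ j ℕ.* (b ℕ.+ c) ≡ e ℕ.+ (c ℕ.+ (j ℕ.+ k) ℕ.* (b ℕ.+ c))
        arith = solve-∀
    ... | inj₂ N′<j = from-above N′ (j ∸ suc N′) (ℕ.m+[n∸m]≡n N′<j)
      where
      from-above : ∀ N′ m {j} → suc N′ ℕ.+ m ≡ j → E j (suc N′) ℕ.+ j ℕ.* a ≡ E j N′ ℕ.+ (c ℕ.+ N′ ℕ.* a)
      from-above N′ m refl = begin
        E (suc N′ ℕ.+ m) (suc N′) ℕ.+ (suc N′ ℕ.+ m) ℕ.* a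
          ≡⟨ cong (ℕ._+ (suc N′ ℕ.+ m) ℕ.* a) (E-above (suc N′) m) ⟩
        eP m ℕ.+ (suc N′ ℕ.+ m) ℕ.* a
          ≡⟨ arith (eP m) b c N′ m ⟩
        eP m ℕ.+ (b ℕ.+ m ℕ.* a) ℕ.+ (c ℕ.+ N′ ℕ.* a)
          ≡⟨ cong (ℕ._+ (c ℕ.+ N′ ℕ.* a)) (eP-suc m) ⟨
        eP (suc m) ℕ.+ (c ℕ.+ N′ ℕ.* a)
          ≡⟨ cong (ℕ._+ (c ℕ.+ N′ ℕ.* a)) (trans (cong (λ x → E x N′) (sym (ℕ.+-suc N′ m))) (E-above N′ (suc m))) ⟨
        E (suc N′ ℕ.+ m) N′ ℕ.+ (c ℕ.+ N′ ℕ.* a)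
          ∎
        where
        open ≡-Reasoning
        arith : ∀ e b c N′ m → e ℕ.+ (suc N′ ℕ.+ m) ℕ.* (b ℕ.+ c) ≡ e ℕ.+ (b ℕ.+ m ℕ.* (b ℕ.+ c)) ℕ.+ (c ℕ.+ N′ ℕ.* (b ℕ.+ c))
        arith = solve-∀

    term : ℕ → ℕ → ℕ → Series
    term M N′ j = signed (j ℕ.+ N′) (q^ E j N′ ⊛ gauss M j)

    jacobiSum : ℕ → ℕ → Series
    jacobiSum M N′ = ∑ₛ (suc M) (term M N′)

    bFactor cFactor : ℕ → Series
    bFactor i = 1-q^ (b ℕ.+ i ℕ.* a)
    cFactor i = 1-q^ (c ℕ.+ i ℕ.* a)

    jacobiProduct : ℕ → ℕ → Series
    jacobiProduct N N′ = ∏ bFactor N ⊛ ∏ cFactor N′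

    q^-t^-exchange : ∀ e k e₁ e₂ Y → e ℕ.+ k ℕ.* a ≡ e₁ ℕ.+ e₂ → q^ e ⊛ (t^ k ⊛ Y) ≈ q^ e₂ ⊛ (q^ e₁ ⊛ Y)
    q^-t^-exchange e k e₁ e₂ Y exponents = begin
      q^ e ⊛ (t^ k ⊛ Y)        ≈⟨ ⊛-assoc (q^ e) (t^ k) Y ⟨
      (q^ e ⊛ t^ k) ⊛ Y        ≈⟨ ⊛-congʳ Y (q^-+ e (k ℕ.* a)) ⟩
      q^ (e ℕ.+ k ℕ.* a) ⊛ Y   ≡⟨ cong (λ x → q^ x ⊛ Y) (trans exponents (ℕ.+-comm e₁ e₂)) ⟩
      q^ (e₂ ℕ.+ e₁) ⊛ Y       ≈⟨ ⊛-congʳ Y (q^-+ e₂ e₁) ⟨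
      (q^ e₂ ⊛ q^ e₁) ⊛ Y      ≈⟨ ⊛-assoc (q^ e₂) (q^ e₁) Y ⟩
      q^ e₂ ⊛ (q^ e₁ ⊛ Y)      ∎
      where open ≈-Reasoning

    jacobiSum-⊛-1-q^ : ∀ M N′ P → jacobiSum M N′ ⊕ ∑ₛ[ j < suc M ] (⊝ (q^ P ⊛ term M N′ j)) ≈ jacobiSum M N′ ⊛ 1-q^ P
    jacobiSum-⊛-1-q^ M N′ P = begin
      S ⊕ ∑ₛ[ j < suc M ] (⊝ (q^ P ⊛ term M N′ j))   ≈⟨ ⊕-congˡ S (∑ₛ-⊝ (suc M) (λ j → q^ P ⊛ term M N′ j)) ⟩
      S ⊕ ⊝ ∑ₛ[ j < suc M ] (q^ P ⊛ term M N′ j)     ≈⟨ ⊕-congˡ S (⊝-cong (⊛-∑ₛ (suc M) (q^ P) (term M N′))) ⟨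
      S ⊕ ⊝ (q^ P ⊛ S)                               ≈⟨ factor S (q^ P) ⟩
      S ⊛ 1-q^ P                                     ∎
      where
      open ≈-Reasoning
      S : Series
      S = jacobiSum M N′
      factor : ∀ A P → A ⊕ ⊝ (P ⊛ A) ≈ A ⊛ (𝟙 ⊕ ⊝ P)
      factor = solve 2 (λ A P → A :+ :- (P :* A) := A :* (con 1ℤ :+ :- P)) ≈-refl

    term-top : ∀ M N′ → term M N′ (suc M) ≈ 𝟘
    term-top M N′ = ≈-trans (signed-cong (suc M ℕ.+ N′) (≈-trans (⊛-congˡ (q^ E (suc M) N′) (gauss-> M (suc M) ℕ.≤-refl))
                                                                (zeroʳ (q^ E (suc M) N′))))
                            (signed-𝟘 (suc M ℕ.+ N′))

    term-split-N : ∀ N N′ i → i ≤ N ℕ.+ N′ →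
                   term (suc (N ℕ.+ N′)) N′ (suc i) ≈ term (N ℕ.+ N′) N′ (suc i) ⊕ ⊝ (q^ (b ℕ.+ N ℕ.* a) ⊛ term (N ℕ.+ N′) N′ i)
    term-split-N N N′ i i≤M = begin
      signed (suc i ℕ.+ N′) (q^ E (suc i) N′ ⊛ (gauss M (suc i) ⊕ t^ (M ∸ i) ⊛ gauss M i))
        ≈⟨ signed-cong (suc i ℕ.+ N′) (⊛-distribˡ-⊕ (q^ E (suc i) N′) (gauss M (suc i)) (t^ (M ∸ i) ⊛ gauss M i)) ⟩
      signed (suc i ℕ.+ N′) (q^ E (suc i) N′ ⊛ gauss M (suc i) ⊕ q^ E (suc i) N′ ⊛ (t^ (M ∸ i) ⊛ gauss M i))
        ≈⟨ signed-⊕ (suc i ℕ.+ N′) (q^ E (suc i) N′ ⊛ gauss M (suc i)) (q^ E (suc i) N′ ⊛ (t^ (M ∸ i) ⊛ gauss M i)) ⟩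
      term M N′ (suc i) ⊕ ⊝ signed (i ℕ.+ N′) (q^ E (suc i) N′ ⊛ (t^ (M ∸ i) ⊛ gauss M i))
        ≈⟨ ⊕-congˡ (term M N′ (suc i)) (⊝-cong (signed-cong (i ℕ.+ N′)
             (q^-t^-exchange (E (suc i) N′) (M ∸ i) (E i N′) P (gauss M i) (E-step-N N N′ i i≤M)))) ⟩
      term M N′ (suc i) ⊕ ⊝ signed (i ℕ.+ N′) (q^ P ⊛ (q^ E i N′ ⊛ gauss M i))
        ≈⟨ ⊕-congˡ (term M N′ (suc i)) (⊝-cong (⊛-signed (i ℕ.+ N′) (q^ P) (q^ E i N′ ⊛ gauss M i))) ⟨
      term M N′ (suc i) ⊕ ⊝ (q^ P ⊛ term M N′ i)
        ∎
      where
      open ≈-Reasoning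
      M : ℕ
      M = N ℕ.+ N′
      P : ℕ
      P = b ℕ.+ N ℕ.* a

    jacobiSum-step-N : ∀ N N′ → jacobiSum (suc (N ℕ.+ N′)) N′ ≈ jacobiSum (N ℕ.+ N′) N′ ⊛ bFactor N
    jacobiSum-step-N N N′ = begin
      jacobiSum (suc M) N′
        ≡⟨⟩
      term (suc M) N′ 0 ⊕ ∑ₛ[ i < suc M ] term (suc M) N′ (suc i)
        ≈⟨ ⊕-congˡ (term (suc M) N′ 0) (∑ₛ-cong (suc M) (λ i i≤M → term-split-N N N′ i (ℕ.≤-pred i≤M))) ⟩
      term (suc M) N′ 0 ⊕ ∑ₛ[ i < suc M ] (term M N′ (suc i) ⊕ ⊝ (q^ P ⊛ term M N′ i))
        ≈⟨ ⊕-congˡ (term (suc M) N′ 0) (∑ₛ-⊕ (suc M) (λ i → term M N′ (suc i)) (λ i → ⊝ (q^ P ⊛ term M N′ i))) ⟩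
      term (suc M) N′ 0 ⊕ (∑ₛ[ i < suc M ] term M N′ (suc i) ⊕ Shifted)
        ≈⟨ ⊕-assoc (term (suc M) N′ 0) (∑ₛ[ i < suc M ] term M N′ (suc i)) Shifted ⟨
      (term (suc M) N′ 0 ⊕ ∑ₛ[ i < suc M ] term M N′ (suc i)) ⊕ Shifted
        ≈⟨ ⊕-congʳ Shifted (⊕-congʳ (∑ₛ[ i < suc M ] term M N′ (suc i))
                                    (signed-cong N′ (⊛-congˡ (q^ E 0 N′) (≈-sym (gauss-zero M))))) ⟩
      ∑ₛ (suc (suc M)) (term M N′) ⊕ Shifted
        ≈⟨ ⊕-congʳ Shifted (∑ₛ-drop-last (suc M) (term M N′) (term-top M N′)) ⟩
      jacobiSum M N′ ⊕ Shifted
        ≈⟨ jacobiSum-⊛-1-q^ M N′ P ⟩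
      jacobiSum M N′ ⊛ bFactor N
        ∎
      where
      open ≈-Reasoning
      M : ℕ
      M = N ℕ.+ N′
      P : ℕ
      P = b ℕ.+ N ℕ.* a
      Shifted : Series
      Shifted = ∑ₛ[ i < suc M ] (⊝ (q^ P ⊛ term M N′ i))

    termBelow : ℕ → ℕ → ℕ → Series
    termBelow M N′ zero = 𝟘
    termBelow M N′ (suc i) = term M N′ i

    term-split-N′ : ∀ M N′ j → term (suc M) (suc N′) j ≈ ⊝ (q^ (c ℕ.+ N′ ℕ.* a) ⊛ term M N′ j) ⊕ termBelow M N′ j
    term-split-N′ M N′ j = begin
      signed (j ℕ.+ suc N′) (q^ E′ ⊛ gauss (suc M) j)
        ≈⟨ signed-cong (j ℕ.+ suc N′) (≈-trans (⊛-congˡ (q^ E′) (gauss-suc M j))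
                                               (⊛-distribˡ-⊕ (q^ E′) (t^ j ⊛ gauss M j) (gaussBelow M j))) ⟩
      signed (j ℕ.+ suc N′) (q^ E′ ⊛ (t^ j ⊛ gauss M j) ⊕ q^ E′ ⊛ gaussBelow M j)
        ≈⟨ signed-⊕ (j ℕ.+ suc N′) (q^ E′ ⊛ (t^ j ⊛ gauss M j)) (q^ E′ ⊛ gaussBelow M j) ⟩
      signed (j ℕ.+ suc N′) (q^ E′ ⊛ (t^ j ⊛ gauss M j)) ⊕ signed (j ℕ.+ suc N′) (q^ E′ ⊛ gaussBelow M j)
        ≈⟨ ⊕-cong shifted (below j) ⟩
      ⊝ (q^ P ⊛ term M N′ j) ⊕ termBelow M N′ j
        ∎
      where
      open ≈-Reasoning
      E′ : ℕ
      E′ = E j (suc N′)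
      P : ℕ
      P = c ℕ.+ N′ ℕ.* a
      shifted : signed (j ℕ.+ suc N′) (q^ E′ ⊛ (t^ j ⊛ gauss M j)) ≈ ⊝ (q^ P ⊛ term M N′ j)
      shifted = begin
        signed (j ℕ.+ suc N′) (q^ E′ ⊛ (t^ j ⊛ gauss M j))    ≡⟨ cong (λ k → signed k (q^ E′ ⊛ (t^ j ⊛ gauss M j))) (ℕ.+-suc j N′) ⟩
        ⊝ signed (j ℕ.+ N′) (q^ E′ ⊛ (t^ j ⊛ gauss M j))      ≈⟨ ⊝-cong (signed-cong (j ℕ.+ N′)
                                                                    (q^-t^-exchange E′ j (E j N′) P (gauss M j) (E-step-N′ N′ j))) ⟩
        ⊝ signed (j ℕ.+ N′) (q^ P ⊛ (q^ E j N′ ⊛ gauss M j))  ≈⟨ ⊝-cong (⊛-signed (j ℕ.+ N′) (q^ P) (q^ E j N′ ⊛ gauss M j)) ⟨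
        ⊝ (q^ P ⊛ term M N′ j)                                ∎
      below : ∀ j → signed (j ℕ.+ suc N′) (q^ E j (suc N′) ⊛ gaussBelow M j) ≈ termBelow M N′ j
      below zero = ≈-trans (signed-cong (suc N′) (zeroʳ (q^ E 0 (suc N′)))) (signed-𝟘 (suc N′))
      below (suc i) = ≈-trans (≡⇒≈ (cong (λ k → signed (suc k) (q^ E i N′ ⊛ gauss M i)) (ℕ.+-suc i N′)))
                              (signed-suc-suc (i ℕ.+ N′) (q^ E i N′ ⊛ gauss M i))

    jacobiSum-step-N′ : ∀ M N′ → jacobiSum (suc M) (suc N′) ≈ jacobiSum M N′ ⊛ cFactor N′
    jacobiSum-step-N′ M N′ = begin
      jacobiSum (suc M) (suc N′)
        ≈⟨ ∑ₛ-cong (suc (suc M)) (λ j _ → term-split-N′ M N′ j) ⟩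
      ∑ₛ[ j < suc (suc M) ] (Shifted j ⊕ termBelow M N′ j)
        ≈⟨ ∑ₛ-⊕ (suc (suc M)) Shifted (termBelow M N′) ⟩
      ∑ₛ (suc (suc M)) Shifted ⊕ ∑ₛ (suc (suc M)) (termBelow M N′)
        ≈⟨ ⊕-cong (∑ₛ-drop-last (suc M) Shifted (≈-trans (⊝-cong (≈-trans (⊛-congˡ (q^ P) (term-top M N′)) (zeroʳ (q^ P)))) ⊝-𝟘))
                  (∑ₛ-drop-first (suc M) (termBelow M N′) ≈-refl) ⟩
      ∑ₛ (suc M) Shifted ⊕ jacobiSum M N′
        ≈⟨ ⊕-comm (∑ₛ (suc M) Shifted) (jacobiSum M N′) ⟩
      jacobiSum M N′ ⊕ ∑ₛ (suc M) Shifted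
        ≈⟨ jacobiSum-⊛-1-q^ M N′ P ⟩
      jacobiSum M N′ ⊛ cFactor N′
        ∎
      where
      open ≈-Reasoning
      P : ℕ
      P = c ℕ.+ N′ ℕ.* a
      Shifted : ℕ → Series
      Shifted j = ⊝ (q^ P ⊛ term M N′ j)

    finite-jacobi : ∀ N N′ → jacobiProduct N N′ ≈ jacobiSum (N ℕ.+ N′) N′
    finite-jacobi zero zero = mk≈ λ n → sym (ℤ.+-identityʳ _)
    finite-jacobi (suc N) zero = begin
      (∏ bFactor N ⊛ bFactor N) ⊛ 𝟙       ≈⟨ exchange (∏ bFactor N) (bFactor N) ⟩
      (∏ bFactor N ⊛ 𝟙) ⊛ bFactor N       ≈⟨ ⊛-congʳ (bFactor N) (finite-jacobi N zero) ⟩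
      jacobiSum (N ℕ.+ 0) 0 ⊛ bFactor N    ≈⟨ jacobiSum-step-N N 0 ⟨
      jacobiSum (suc N ℕ.+ 0) 0             ∎
      where
      open ≈-Reasoning
      exchange : ∀ P Q → (P ⊛ Q) ⊛ 𝟙 ≈ (P ⊛ 𝟙) ⊛ Q
      exchange = solve 2 (λ P Q → (P :* Q) :* con 1ℤ := (P :* con 1ℤ) :* Q) ≈-refl
    finite-jacobi N (suc N′) = begin
      ∏ bFactor N ⊛ (∏ cFactor N′ ⊛ cFactor N′)   ≈⟨ ⊛-assoc (∏ bFactor N) (∏ cFactor N′) (cFactor N′) ⟨
      jacobiProduct N N′ ⊛ cFactor N′               ≈⟨ ⊛-congʳ (cFactor N′) (finite-jacobi N N′) ⟩
      jacobiSum (N ℕ.+ N′) N′ ⊛ cFactor N′          ≈⟨ jacobiSum-step-N′ (N ℕ.+ N′) N′ ⟨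
      jacobiSum (suc (N ℕ.+ N′)) (suc N′)            ≡⟨ cong (λ M → jacobiSum M (suc N′)) (ℕ.+-suc N N′) ⟨
      jacobiSum (N ℕ.+ suc N′) (suc N′)              ∎
      where
      open ≈-Reasoning

    tripleProduct : ℕ → Series
    tripleProduct N = tPoch N ⊛ jacobiProduct N N

    tripleProduct-zero : tripleProduct 0 ≈ 𝟙
    tripleProduct-zero = ≈-trans (⊛-identityˡ (𝟙 ⊛ 𝟙)) (⊛-identityˡ 𝟙)

    tripleProduct-suc : ∀ N → tripleProduct (suc N) ≈ tripleProduct N ⊛ (bFactor N ⊛ (cFactor N ⊛ 1-t^ suc N))
    tripleProduct-suc N = regroup (tPoch N) (1-t^ suc N) (∏ bFactor N) (bFactor N) (∏ cFactor N) (cFactor N)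
      where
      regroup : ∀ A B C D E F → (A ⊛ B) ⊛ ((C ⊛ D) ⊛ (E ⊛ F)) ≈ (A ⊛ (C ⊛ E)) ⊛ (D ⊛ (F ⊛ B))
      regroup = solve 6 (λ A B C D E F → (A :* B) :* ((C :* D) :* (E :* F)) := (A :* (C :* E)) :* (D :* (F :* B))) ≈-refl

    δ : ℕ → ℕ → ℤ
    δ e d with e ℕ.≟ d
    ... | yes _ = 1ℤ
    ... | no _ = 0ℤ

    δ-≡ : ∀ {e d} → e ≡ d → δ e d ≡ 1ℤ
    δ-≡ {e} {d} e≡d with e ℕ.≟ d
    ... | yes _ = refl
    ... | no e≢d = ⊥-elim (e≢d e≡d)

    δ-≢ : ∀ {e d} → e ≢ d → δ e d ≡ 0ℤ
    δ-≢ {e} {d} e≢d with e ℕ.≟ d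
    ... | yes e≡d = ⊥-elim (e≢d e≡d)
    ... | no _ = refl

    signed-coeff : ∀ k f n → signed k f n ≡ signPow k ℤ.* f n
    signed-coeff zero f n = sym (ℤ.*-identityˡ (f n))
    signed-coeff (suc k) f n = trans (cong -_ (signed-coeff k f n)) (ℤ.neg-distribˡ-* (signPow k) (f n))

    thetaSum : ℕ → ℕ → ℤ
    thetaSum N d = ∑[ j < suc (N ℕ.+ N) ] (signPow (j ℕ.+ N) ℤ.* δ (E j N) d)

    module Coefficients (1≤b : 1 ≤ b) (1≤c : 1 ≤ c) where

      private instance
        a≢0 : ℕ.NonZero a
        a≢0 = ℕ.>-nonZero (ℕ.≤-trans 1≤b (ℕ.m≤m+n b c))

      open Truncated

      m≤eP : ∀ m → m ≤ eP m
      m≤eP m = ℕ.≤-trans (ℕ.m≤m*n m b {{ℕ.>-nonZero 1≤b}}) (ℕ.m≤m+n _ _)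

      m≤eN : ∀ m → m ≤ eN m
      m≤eN m = ℕ.≤-trans (ℕ.m≤m*n m c {{ℕ.>-nonZero 1≤c}}) (ℕ.m≤m+n _ _)

      q^-⊛-≈𝟙 : ∀ e d g t → g ≈[< suc t ] 𝟙 → d ∸ e ≤ t → (q^ e ⊛ g) d ≡ δ e d
      q^-⊛-≈𝟙 e d g t g≈𝟙 d∸e≤t with ℕ.≤-<-connex e d
      ... | inj₁ e≤d = trans (at (q^-⊛ e g) d) (trans (shift-≥ e g d e≤d) (trans (g≈𝟙 (d ∸ e) (s≤s d∸e≤t)) (𝟙-at (d ∸ e) refl)))
        where
        𝟙-at : ∀ k → d ∸ e ≡ k → 𝟙 k ≡ δ e d
        𝟙-at zero d∸e≡0 = sym (δ-≡ (ℕ.≤-antisym e≤d (ℕ.m∸n≡0⇒m≤n d∸e≡0)))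
        𝟙-at (suc k) d∸e≡1+k = sym (δ-≢ λ e≡d → ℕ.0≢1+n (trans (sym (trans (cong (d ∸_) e≡d) (ℕ.n∸n≡0 d))) d∸e≡1+k))
      ... | inj₂ d<e = trans (at (q^-⊛ e g) d) (trans (shift-< e g d d<e) (sym (δ-≢ λ e≡d → ℕ.<-irrefl (sym e≡d) d<e)))

      term-coeff : ∀ N d j → d ≤ N → j ≤ N ℕ.+ N → (q^ E j N ⊛ (tPoch N ⊛ gauss (N ℕ.+ N) j)) d ≡ δ (E j N) d
      term-coeff N d j d≤N j≤2N with ℕ.≤-total j N
      ... | inj₁ j≤N = q^-⊛-≈𝟙 (E j N) d (tPoch N ⊛ gauss (N ℕ.+ N) j) j (tPoch-gauss-≈[<]-𝟙 N j j≤N)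
          (subst (d ∸ E j N ≤_) (ℕ.m∸[m∸n]≡n j≤N)
                 (ℕ.∸-mono d≤N (ℕ.≤-trans (m≤eN (N ∸ j)) (ℕ.m≤n+m (eN (N ∸ j)) (eP (j ∸ N))))))
      ... | inj₂ N≤j = q^-⊛-≈𝟙 (E j N) d (tPoch N ⊛ gauss (N ℕ.+ N) j) u
          (≈[<]-trans (≈⇒≈[<] (⊛-congˡ (tPoch N) (gauss-sym (N ℕ.+ N) j j≤2N))) (tPoch-gauss-≈[<]-𝟙 N u u≤N))
          (subst (d ∸ E j N ≤_) N∸[j∸N]≡u (ℕ.∸-mono d≤N (ℕ.≤-trans (m≤eP (j ∸ N)) (ℕ.m≤m+n _ _))))
        where
        u : ℕ
        u = (N ℕ.+ N) ∸ j
        u≤N : u ≤ N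
        u≤N = subst (u ≤_) (ℕ.m+n∸n≡m N N) (ℕ.∸-monoʳ-≤ (N ℕ.+ N) N≤j)
        N∸[j∸N]≡u : N ∸ (j ∸ N) ≡ u
        N∸[j∸N]≡u = begin
          N ∸ (j ∸ N)                  ≡⟨ cong (_∸ (j ∸ N)) (ℕ.m+n∸n≡m N N) ⟨
          ((N ℕ.+ N) ∸ N) ∸ (j ∸ N)    ≡⟨ ℕ.∸-+-assoc (N ℕ.+ N) N (j ∸ N) ⟩
          (N ℕ.+ N) ∸ (N ℕ.+ (j ∸ N))  ≡⟨ cong ((N ℕ.+ N) ∸_) (ℕ.m+[n∸m]≡n N≤j) ⟩
          (N ℕ.+ N) ∸ j                ∎
          where open ≡-Reasoning

      -- Below degree N + 1, each term (t;t)_N q^(E j N) [2N choose j] of tripleProduct N is just q^(E j N).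
      tripleProduct-coeff : ∀ N d → d ≤ N → tripleProduct N d ≡ thetaSum N d
      tripleProduct-coeff N d d≤N = trans (at expand d) (∑-cong (suc (N ℕ.+ N)) λ j j≤2N →
        trans (signed-coeff (j ℕ.+ N) (q^ E j N ⊛ (tPoch N ⊛ gauss (N ℕ.+ N) j)) d)
              (cong (signPow (j ℕ.+ N) ℤ.*_) (term-coeff N d j d≤N (ℕ.≤-pred j≤2N))))
        where
        rotate : ∀ P Q S → P ⊛ (Q ⊛ S) ≈ Q ⊛ (P ⊛ S)
        rotate = solve 3 (λ P Q S → P :* (Q :* S) := Q :* (P :* S)) ≈-refl
        expand : tripleProduct N ≈ ∑ₛ[ j < suc (N ℕ.+ N) ] signed (j ℕ.+ N) (q^ E j N ⊛ (tPoch N ⊛ gauss (N ℕ.+ N) j))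
        expand = ≈-trans (⊛-congˡ (tPoch N) (finite-jacobi N N))
          (≈-trans (⊛-∑ₛ (suc (N ℕ.+ N)) (tPoch N) (term (N ℕ.+ N) N))
            (∑ₛ-cong (suc (N ℕ.+ N)) λ j _ →
              ≈-trans (⊛-signed (j ℕ.+ N) (tPoch N) (q^ E j N ⊛ gauss (N ℕ.+ N) j))
                      (signed-cong (j ℕ.+ N) (rotate (tPoch N) (q^ E j N) (gauss (N ℕ.+ N) j)))))

    ThetaExponent : ℕ → ℕ → Set
    ThetaExponent m d = d ≡ eP m ⊎ (1 ≤ m × d ≡ eN m)

    eP-suc-eN : ∀ m → eP (suc m) ≡ eN m ℕ.+ (b ℕ.+ m ℕ.* b ℕ.+ m ℕ.* b)
    eP-suc-eN m = step m (triangle m) b c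
      where
      step : ∀ m T b c → suc m ℕ.* b ℕ.+ (T ℕ.+ m) ℕ.* (b ℕ.+ c) ≡ m ℕ.* c ℕ.+ T ℕ.* (b ℕ.+ c) ℕ.+ (b ℕ.+ m ℕ.* b ℕ.+ m ℕ.* b)
      step = solve-∀

    module Evaluation (1≤b : 1 ≤ b) (b<c : b < c) where

      private
        1≤c : 1 ≤ c
        1≤c = ℕ.<⇒≤ (ℕ.≤-<-trans 1≤b b<c)

      open Coefficients 1≤b 1≤c

      eP-< : ∀ m → eP m < eP (suc m)
      eP-< m = subst (eP m <_) (sym (eP-suc m)) (ℕ.m<m+n (eP m) (ℕ.≤-trans 1≤b (ℕ.m≤m+n b _)))

      eN-< : ∀ m → eN m < eN (suc m)
      eN-< m = subst (eN m <_) (sym (eN-suc m)) (ℕ.m<m+n (eN m) (ℕ.≤-trans 1≤c (ℕ.m≤m+n c _)))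

      module eP = Increasing eP eP-<
      module eN = Increasing eN eN-<

      eP≢eN : ∀ m m′ → 1 ≤ m′ → eP m ≢ eN m′
      eP≢eN m m′@(suc _) _ eP≡eN with ℕ.≤-<-connex m m′
      ... | inj₁ m≤m′ = ℕ.<-irrefl eP≡eN (ℕ.≤-<-trans (eP.≤-mono m≤m′) eP<eN)
        where
        eP<eN : eP m′ < eN m′
        eP<eN = ℕ.+-monoˡ-< (triangle m′ ℕ.* a) (ℕ.*-monoʳ-< m′ b<c)
      ... | inj₂ m′<m = ℕ.<-irrefl (sym eP≡eN) (ℕ.<-≤-trans eN<eP (eP.≤-mono m′<m))
        where
        eN<eP : eN m′ < eP (suc m′)
        eN<eP = subst (eN m′ <_) (sym (eP-suc-eN m′))
                  (ℕ.m<m+n (eN m′) (ℕ.≤-trans 1≤b (ℕ.≤-trans (ℕ.m≤m+n b (m′ ℕ.* b)) (ℕ.m≤m+n _ _))))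

      ThetaExponent-≤ : ∀ {m d} → ThetaExponent m d → m ≤ d
      ThetaExponent-≤ {m} (inj₁ d≡eP) = subst (m ≤_) (sym d≡eP) (m≤eP m)
      ThetaExponent-≤ {m} (inj₂ (_ , d≡eN)) = subst (m ≤_) (sym d≡eN) (m≤eN m)

      ThetaExponent-unique : ∀ {m m′ d} → ThetaExponent m d → ThetaExponent m′ d → m ≡ m′
      ThetaExponent-unique (inj₁ e) (inj₁ e′) = eP.injective (trans (sym e) e′)
      ThetaExponent-unique {m} {m′} (inj₁ e) (inj₂ (1≤m′ , e′)) = ⊥-elim (eP≢eN m m′ 1≤m′ (trans (sym e) e′))
      ThetaExponent-unique {m} {m′} (inj₂ (1≤m , e)) (inj₁ e′) = ⊥-elim (eP≢eN m′ m 1≤m (trans (sym e′) e))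
      ThetaExponent-unique (inj₂ (_ , e)) (inj₂ (_ , e′)) = eN.injective (trans (sym e) e′)

      thetaSum-single : ∀ N d j₀ → j₀ ≤ N ℕ.+ N → E j₀ N ≡ d → (∀ j → E j N ≡ d → j ≡ j₀) →
                        thetaSum N d ≡ signPow (j₀ ℕ.+ N)
      thetaSum-single N d j₀ j₀≤2N E≡d unique = begin
        thetaSum N d                            ≡⟨ ∑-single (suc (N ℕ.+ N)) j₀ _ (s≤s j₀≤2N) (λ j _ j≢j₀ →
                                                     trans (cong (signPow (j ℕ.+ N) ℤ.*_) (δ-≢ (j≢j₀ ∘ unique j)))
                                                           (ℤ.*-zeroʳ (signPow (j ℕ.+ N)))) ⟩
        signPow (j₀ ℕ.+ N) ℤ.* δ (E j₀ N) d     ≡⟨ cong (signPow (j₀ ℕ.+ N) ℤ.*_) (δ-≡ E≡d) ⟩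
        signPow (j₀ ℕ.+ N) ℤ.* 1ℤ               ≡⟨ ℤ.*-identityʳ _ ⟩
        signPow (j₀ ℕ.+ N)                      ∎
        where open ≡-Reasoning

      thetaSum-exponent : ∀ N d m → d ≤ N → ThetaExponent m d → thetaSum N d ≡ signPow m
      thetaSum-exponent N d m d≤N (inj₁ d≡eP) = trans
        (thetaSum-single N d (N ℕ.+ m) (ℕ.+-monoʳ-≤ N m≤N) (trans (E-above N m) (sym d≡eP)) unique)
        (signPow-parity (N ℕ.+ m ℕ.+ N) m (N ℕ.+ m) (arith N m))
        where
        m≤N : m ≤ N
        m≤N = ℕ.≤-trans (ThetaExponent-≤ (inj₁ d≡eP)) d≤N
        arith : ∀ N m → N ℕ.+ m ℕ.+ N ℕ.+ m ≡ N ℕ.+ m ℕ.+ (N ℕ.+ m)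
        arith = solve-∀
        unique : ∀ j → E j N ≡ d → j ≡ N ℕ.+ m
        unique j E≡d with ℕ.≤-<-connex N j
        ... | inj₁ N≤j = trans (sym (ℕ.m+[n∸m]≡n N≤j)) (cong (N ℕ.+_) (eP.injective (trans (sym (E-≥ N≤j)) (trans E≡d d≡eP))))
        ... | inj₂ j<N = ⊥-elim (eP≢eN m (N ∸ j) (ℕ.m<n⇒0<n∸m j<N) (trans (sym d≡eP) (trans (sym E≡d) (E-< j<N))))
      thetaSum-exponent N d m d≤N (inj₂ (1≤m , d≡eN)) = trans
        (thetaSum-single N d (N ∸ m) (ℕ.≤-trans (ℕ.m∸n≤m N m) (ℕ.m≤m+n N N))
          (trans (E-< N∸m<N) (trans (cong eN (ℕ.m∸[m∸n]≡n m≤N)) (sym d≡eN))) unique)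
        (signPow-parity (N ∸ m ℕ.+ N) m N arith)
        where
        m≤N : m ≤ N
        m≤N = ℕ.≤-trans (ThetaExponent-≤ (inj₂ (1≤m , d≡eN))) d≤N
        N∸m<N : N ∸ m < N
        N∸m<N = ℕ.∸-monoʳ-< {N} {m} {0} 1≤m m≤N
        arith : N ∸ m ℕ.+ N ℕ.+ m ≡ N ℕ.+ N
        arith = trans (cong (ℕ._+ m) (ℕ.+-comm (N ∸ m) N)) (trans (ℕ.+-assoc N (N ∸ m) m) (cong (N ℕ.+_) (ℕ.m∸n+n≡m m≤N)))
        unique : ∀ j → E j N ≡ d → j ≡ N ∸ m
        unique j E≡d with ℕ.≤-<-connex N j
        ... | inj₁ N≤j = ⊥-elim (eP≢eN (j ∸ N) m 1≤m (trans (sym (E-≥ N≤j)) (trans E≡d d≡eN)))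
        ... | inj₂ j<N = trans (sym (ℕ.m∸[m∸n]≡n (ℕ.<⇒≤ j<N)))
                               (cong (N ∸_) (eN.injective {N ∸ j} {m} (trans (sym (E-< j<N)) (trans E≡d d≡eN))))

      thetaSum-gap : ∀ N d → (∀ m → m ≤ d → ¬ ThetaExponent m d) → thetaSum N d ≡ 0ℤ
      thetaSum-gap N d gap = ∑-zero (suc (N ℕ.+ N)) _ λ j _ →
        trans (cong (signPow (j ℕ.+ N) ℤ.*_) (δ-≢ (E≢d j))) (ℤ.*-zeroʳ (signPow (j ℕ.+ N)))
        where
        not-exponent : ∀ m → ¬ ThetaExponent m d
        not-exponent m e = gap m (ThetaExponent-≤ e) e
        E≢d : ∀ j → E j N ≢ d
        E≢d j E≡d with ℕ.≤-<-connex N j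
        ... | inj₁ N≤j = not-exponent (j ∸ N) (inj₁ (trans (sym E≡d) (E-≥ N≤j)))
        ... | inj₂ j<N = not-exponent (N ∸ j) (inj₂ (ℕ.m<n⇒0<n∸m j<N , trans (sym E≡d) (E-< j<N)))

      tripleProduct-exponent : ∀ N d m → d ≤ N → ThetaExponent m d → tripleProduct N d ≡ signPow m
      tripleProduct-exponent N d m d≤N e = trans (tripleProduct-coeff N d d≤N) (thetaSum-exponent N d m d≤N e)

      tripleProduct-gap : ∀ N d → d ≤ N → (∀ m → m ≤ d → ¬ ThetaExponent m d) → tripleProduct N d ≡ 0ℤ
      tripleProduct-gap N d d≤N gap = trans (tripleProduct-coeff N d d≤N) (thetaSum-gap N d gap)

module Compositions where

  open import Data.Nat as ℕ using (ℕ; zero; suc; _∸_; _≤_; _<_; s≤s)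
  import Data.Nat.Properties as ℕ
  open import Data.Integer as ℤ using (ℤ; -_; _+_; _*_; 0ℤ; 1ℤ)
  import Data.Integer.Properties as ℤ
  open import Data.Bool using (Bool; true; false; if_then_else_)
  open import Data.List using (List; []; _∷_; _++_; map; filter; concatMap; foldr; applyUpTo; upTo)
  open import Relation.Nullary.Decidable using (T?)
  open import Function using (_∘_)
  open import Relation.Binary.PropositionalEquality
  open import Defs
  open FiniteSums
  open PowerSeries

  sumBy : ∀ {A : Set} → (A → ℤ) → List A → ℤ
  sumBy w = foldr (λ x acc → w x + acc) 0ℤ

  sumBy-cong : ∀ {A : Set} {w w′ : A → ℤ} → (∀ x → w x ≡ w′ x) → ∀ xs → sumBy w xs ≡ sumBy w′ xs
  sumBy-cong w≡w′ [] = refl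
  sumBy-cong w≡w′ (x ∷ xs) = cong₂ _+_ (w≡w′ x) (sumBy-cong w≡w′ xs)

  sumBy-++ : ∀ {A : Set} (w : A → ℤ) xs ys → sumBy w (xs ++ ys) ≡ sumBy w xs + sumBy w ys
  sumBy-++ w [] ys = sym (ℤ.+-identityˡ _)
  sumBy-++ w (x ∷ xs) ys = trans (cong (w x +_) (sumBy-++ w xs ys)) (sym (ℤ.+-assoc (w x) _ _))

  sumBy-concatMap : ∀ {A B : Set} (w : B → ℤ) (f : A → List B) xs →
                    sumBy w (concatMap f xs) ≡ sumBy (sumBy w ∘ f) xs
  sumBy-concatMap w f [] = refl
  sumBy-concatMap w f (x ∷ xs) = trans (sumBy-++ w (f x) (concatMap f xs)) (cong (sumBy w (f x) +_) (sumBy-concatMap w f xs))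

  sumBy-map : ∀ {A B : Set} (w : B → ℤ) (h : A → B) xs → sumBy w (map h xs) ≡ sumBy (w ∘ h) xs
  sumBy-map w h [] = refl
  sumBy-map w h (x ∷ xs) = cong (w (h x) +_) (sumBy-map w h xs)

  sumBy-filter : ∀ {A : Set} (w : A → ℤ) (p : A → Bool) xs →
                 sumBy w (filter (λ x → T? (p x)) xs) ≡ sumBy (λ x → if p x then w x else 0ℤ) xs
  sumBy-filter w p [] = refl
  sumBy-filter w p (x ∷ xs) with p x
  ... | true = cong (w x +_) (sumBy-filter w p xs)
  ... | false = trans (sumBy-filter w p xs) (sym (ℤ.+-identityˡ _))

  sumBy-*ˡ : ∀ {A : Set} (w : A → ℤ) k xs → sumBy (λ x → k * w x) xs ≡ k * sumBy w xs
  sumBy-*ˡ w k [] = sym (ℤ.*-zeroʳ k)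
  sumBy-*ˡ w k (x ∷ xs) = trans (cong (k * w x +_) (sumBy-*ˡ w k xs)) (sym (ℤ.*-distribˡ-+ k (w x) _))

  sumBy-applyUpTo : (w : ℕ → ℤ) (f : ℕ → ℕ) → ∀ m → sumBy w (applyUpTo f m) ≡ ∑ m (w ∘ f)
  sumBy-applyUpTo w f zero = refl
  sumBy-applyUpTo w f (suc m) = cong (w (f 0) +_) (sumBy-applyUpTo w (f ∘ suc) m)

  sumBy-oneTo : (w : ℕ → ℤ) → ∀ m → sumBy w (oneTo m) ≡ ∑[ i < m ] w (suc i)
  sumBy-oneTo w m = trans (sumBy-map w suc (upTo m)) (sumBy-applyUpTo (w ∘ suc) (λ i → i) m)

  sumBy-first-part : ∀ (S : ℕ → Bool) (w : ℕ → ℤ) (rest : ℕ → List (List ℕ)) (g : List ℕ → ℤ) n →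
    (∀ p c → g (p ∷ c) ≡ w p * g c) →
    sumBy g (concatMap (λ p → map (p ∷_) (rest p)) (filter (λ p → T? (S p)) (oneTo (suc n))))
    ≡ ∑[ i < suc n ] ((if S (suc i) then w (suc i) else 0ℤ) * sumBy g (rest (suc i)))
  sumBy-first-part S w rest g n g-∷ = begin
    sumBy g (concatMap (λ p → map (p ∷_) (rest p)) (filter (λ p → T? (S p)) (oneTo (suc n))))
      ≡⟨ sumBy-concatMap g (λ p → map (p ∷_) (rest p)) (filter (λ p → T? (S p)) (oneTo (suc n))) ⟩
    sumBy (λ p → sumBy g (map (p ∷_) (rest p))) (filter (λ p → T? (S p)) (oneTo (suc n)))
      ≡⟨ sumBy-cong (λ p → trans (sumBy-map g (p ∷_) (rest p))
                           (trans (sumBy-cong (g-∷ p) (rest p)) (sumBy-*ˡ g (w p) (rest p))))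
                   (filter (λ p → T? (S p)) (oneTo (suc n))) ⟩
    sumBy (λ p → w p * sumBy g (rest p)) (filter (λ p → T? (S p)) (oneTo (suc n)))
      ≡⟨ sumBy-filter (λ p → w p * sumBy g (rest p)) S (oneTo (suc n)) ⟩
    sumBy (λ p → if S p then w p * sumBy g (rest p) else 0ℤ) (oneTo (suc n))
      ≡⟨ sumBy-oneTo (λ p → if S p then w p * sumBy g (rest p) else 0ℤ) (suc n) ⟩
    ∑[ i < suc n ] (if S (suc i) then w (suc i) * sumBy g (rest (suc i)) else 0ℤ)
      ≡⟨ ∑-cong′ (suc n) (λ i → if-* (S (suc i)) (w (suc i)) (sumBy g (rest (suc i)))) ⟩
    ∑[ i < suc n ] ((if S (suc i) then w (suc i) else 0ℤ) * sumBy g (rest (suc i)))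
      ∎
    where
    open ≡-Reasoning
    if-* : ∀ s x y → (if s then x * y else 0ℤ) ≡ (if s then x else 0ℤ) * y
    if-* true x y = refl
    if-* false x y = refl

  hatSign : ℕ → ℤ
  hatSign p = if isPhat p then - 1ℤ else 1ℤ

  compositionSign : List ℕ → ℤ
  compositionSign c = signPow (ellHat c)

  compositionSign-∷ : ∀ p c → compositionSign (p ∷ c) ≡ hatSign p * compositionSign c
  compositionSign-∷ p c with isPhat p
  ... | true = sym (ℤ.-1*i≡-i (compositionSign c))
  ... | false = sym (ℤ.*-identityˡ (compositionSign c))

  module SignedCompositions (S : ℕ → Bool) where

    weight : ℕ → ℤ
    weight p = if S p then hatSign p else 0ℤ

    countF : ℕ → ℕ → ℤ
    countF f m = sumBy compositionSign (compsF S f m)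

    countF-suc : ∀ f n → countF (suc f) (suc n) ≡ ∑[ i < suc n ] (weight (suc i) * countF f (n ∸ i))
    countF-suc f n = sumBy-first-part S hatSign (λ p → compsF S f (suc n ∸ p)) compositionSign n compositionSign-∷

    countF-fuel : ∀ f g m → m ≤ f → m ≤ g → countF f m ≡ countF g m
    countF-fuel f g zero _ _ = refl
    countF-fuel (suc f) (suc g) (suc n) (s≤s n≤f) (s≤s n≤g) = begin
      countF (suc f) (suc n)                            ≡⟨ countF-suc f n ⟩
      ∑[ i < suc n ] (weight (suc i) * countF f (n ∸ i)) ≡⟨ ∑-cong (suc n) (λ i _ → cong (weight (suc i) *_)
                                                             (countF-fuel f g (n ∸ i) (ℕ.≤-trans (ℕ.m∸n≤m n i) n≤f)
                                                                                     (ℕ.≤-trans (ℕ.m∸n≤m n i) n≤g))) ⟩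
      ∑[ i < suc n ] (weight (suc i) * countF g (n ∸ i)) ≡⟨ countF-suc g n ⟨
      countF (suc g) (suc n)                            ∎
      where open ≡-Reasoning

    count : Series
    count n = countF n n

    count-suc : ∀ n → count (suc n) ≡ ∑[ i < suc n ] (weight (suc i) * count (n ∸ i))
    count-suc n = trans (countF-suc n n) (∑-cong (suc n) λ i _ →
      cong (weight (suc i) *_) (countF-fuel n (n ∸ i) (n ∸ i) (ℕ.m∸n≤m n i) ℕ.≤-refl))

    denominator : Series
    denominator zero = 1ℤ
    denominator (suc i) = - weight (suc i)

    denominator-⊛-count : denominator ⊛ count ≈ 𝟙
    denominator-⊛-count = mk≈ λ
      { zero → refl
      ; (suc n) → begin
          1ℤ * count (suc n) + ∑[ i < suc n ] (- weight (suc i) * count (n ∸ i))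
            ≡⟨ cong₂ _+_ (ℤ.*-identityˡ (count (suc n)))
                         (trans (∑-cong′ (suc n) (λ i → sym (ℤ.neg-distribˡ-* (weight (suc i)) (count (n ∸ i)))))
                                (∑-neg (suc n) (λ i → weight (suc i) * count (n ∸ i)))) ⟩
          count (suc n) + - ∑[ i < suc n ] (weight (suc i) * count (n ∸ i))
            ≡⟨ cong (_+ - ∑[ i < suc n ] (weight (suc i) * count (n ∸ i))) (count-suc n) ⟩
          ∑[ i < suc n ] (weight (suc i) * count (n ∸ i)) + - ∑[ i < suc n ] (weight (suc i) * count (n ∸ i))
            ≡⟨ ℤ.+-inverseʳ (∑[ i < suc n ] (weight (suc i) * count (n ∸ i))) ⟩
          0ℤ
            ∎ }
      where open ≡-Reasoning

module Partitions where

  open import Data.Nat as ℕ using (ℕ; zero; suc; _∸_; _≤_; _<_; _≤ᵇ_; s≤s)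
  import Data.Nat.Properties as ℕ
  open import Data.Integer as ℤ using (ℤ; -_; _+_; _-_; _*_; 0ℤ; 1ℤ)
  import Data.Integer.Properties as ℤ
  open import Data.Integer.Tactic.RingSolver using (solve-∀)
  open import Data.Bool using (Bool; true; false; if_then_else_; _∧_; T)
  import Data.Bool.Properties as Bool
  open import Data.Empty using (⊥-elim)
  open import Data.List using (List; []; _∷_; length)
  open import Data.Sum using (inj₁; inj₂)
  open import Function using (Equivalence)
  open import Relation.Binary.PropositionalEquality
  open import Relation.Binary.Definitions using (Tri; tri<; tri≈; tri>)
  open import Defs
  open FiniteSums
  open PowerSeries
  open Compositions

  ≤ᵇ-true : ∀ {m n} → m ≤ n → (m ≤ᵇ n) ≡ true
  ≤ᵇ-true m≤n = Equivalence.to Bool.T-≡ (ℕ.≤⇒≤ᵇ m≤n)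

  ≤ᵇ-false : ∀ {m n} → n < m → (m ≤ᵇ n) ≡ false
  ≤ᵇ-false {m} {n} n<m with m ≤ᵇ n in eq
  ... | false = refl
  ... | true = ⊥-elim (ℕ.<⇒≱ n<m (ℕ.≤ᵇ⇒≤ m n (subst T (sym eq) _)))

  indicator : Bool → ℤ
  indicator b = if b then 1ℤ else 0ℤ

  length-sumBy : ∀ {A : Set} (xs : List A) → ℤ.+ length xs ≡ sumBy (λ _ → 1ℤ) xs
  length-sumBy [] = refl
  length-sumBy (x ∷ xs) = cong (1ℤ +_) (length-sumBy xs)

  module RestrictedPartitions (S : ℕ → Bool) where

    countF : ℕ → ℕ → ℕ → ℤ
    countF f k n = sumBy (λ _ → 1ℤ) (partsF S f k n)

    allowed : ℕ → ℕ → Bool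
    allowed k p = S p ∧ (p ≤ᵇ k)

    countF-suc : ∀ f k n → countF (suc f) k (suc n) ≡ ∑[ i < suc n ] (indicator (allowed k (suc i)) * countF f (suc i) (n ∸ i))
    countF-suc f k n = sumBy-first-part (allowed k) (λ _ → 1ℤ) (λ p → partsF S f p (suc n ∸ p)) (λ _ → 1ℤ) n
                                          (λ _ _ → sym (ℤ.*-identityˡ 1ℤ))

    countF-fuel : ∀ f g k m → m ≤ f → m ≤ g → countF f k m ≡ countF g k m
    countF-fuel f g k zero _ _ = refl
    countF-fuel (suc f) (suc g) k (suc n) (s≤s n≤f) (s≤s n≤g) = begin
      countF (suc f) k (suc n)
        ≡⟨ countF-suc f k n ⟩
      ∑[ i < suc n ] (indicator (allowed k (suc i)) * countF f (suc i) (n ∸ i))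
        ≡⟨ ∑-cong (suc n) (λ i _ → cong (indicator (allowed k (suc i)) *_)
             (countF-fuel f g (suc i) (n ∸ i) (ℕ.≤-trans (ℕ.m∸n≤m n i) n≤f) (ℕ.≤-trans (ℕ.m∸n≤m n i) n≤g))) ⟩
      ∑[ i < suc n ] (indicator (allowed k (suc i)) * countF g (suc i) (n ∸ i))
        ≡⟨ countF-suc g k n ⟨
      countF (suc g) k (suc n)
        ∎
      where open ≡-Reasoning

    bounded : ℕ → Series
    bounded k n = countF n k n

    bounded-term : ℕ → ℕ → ℕ → ℤ
    bounded-term k n i = indicator (allowed k (suc i)) * bounded (suc i) (n ∸ i)

    bounded-suc : ∀ k n → bounded k (suc n) ≡ ∑[ i < suc n ] bounded-term k n i
    bounded-suc k n = trans (countF-suc n k n) (∑-cong (suc n) λ i _ →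
      cong (indicator (allowed k (suc i)) *_) (countF-fuel n (n ∸ i) (suc i) (n ∸ i) (ℕ.m∸n≤m n i) ℕ.≤-refl))

    bounded-≥ : ∀ k n → n ≤ k → bounded k n ≡ bounded n n
    bounded-≥ k zero _ = refl
    bounded-≥ k (suc n) 1+n≤k = begin
      bounded k (suc n)
        ≡⟨ bounded-suc k n ⟩
      ∑[ i < suc n ] bounded-term k n i
        ≡⟨ ∑-cong (suc n) (λ i i≤n → cong (λ x → indicator (S (suc i) ∧ x) * bounded (suc i) (n ∸ i))
                                          (trans (≤ᵇ-true (ℕ.≤-trans i≤n 1+n≤k)) (sym (≤ᵇ-true i≤n)))) ⟩
      ∑[ i < suc n ] bounded-term (suc n) n i
        ≡⟨ bounded-suc (suc n) n ⟨
      bounded (suc n) (suc n)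
        ∎
      where open ≡-Reasoning

    bounded-zero : bounded 0 ≈ 𝟙
    bounded-zero = mk≈ λ
      { zero → refl
      ; (suc n) → trans (bounded-suc 0 n) (∑-zero (suc n) (bounded-term 0 n) λ i _ →
                    cong (λ x → indicator x * bounded (suc i) (n ∸ i)) (Bool.∧-zeroʳ (S (suc i)))) }

    bounded-term-suc : ∀ k n i → i ≢ k → bounded-term (suc k) n i ≡ bounded-term k n i
    bounded-term-suc k n i i≢k = cong (λ x → indicator (S (suc i) ∧ x) * bounded (suc i) (n ∸ i)) (same-test (ℕ.<-cmp i k))
      where
      same-test : Tri (i < k) (i ≡ k) (k < i) → (suc i ≤ᵇ suc k) ≡ (suc i ≤ᵇ k)
      same-test (tri< i<k _ _) = trans (≤ᵇ-true (ℕ.m≤n⇒m≤1+n i<k)) (sym (≤ᵇ-true i<k))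
      same-test (tri≈ _ i≡k _) = ⊥-elim (i≢k i≡k)
      same-test (tri> _ _ k<i) = trans (≤ᵇ-false (s≤s k<i)) (sym (≤ᵇ-false (ℕ.m<n⇒m<1+n k<i)))

    bounded-step : ∀ k n → bounded (suc k) n ≡ bounded k n + indicator (S (suc k)) * shift (suc k) (bounded (suc k)) n
    bounded-step k zero = sym (trans (cong (bounded k 0 +_) (ℤ.*-zeroʳ (indicator (S (suc k))))) (ℤ.+-identityʳ _))
    bounded-step k (suc n) with ℕ.≤-<-connex k n
    ... | inj₁ k≤n = begin
      bounded (suc k) (suc n)                                              ≡⟨ bounded-suc (suc k) n ⟩
      ∑[ i < suc n ] bounded-term (suc k) n i                              ≡⟨ ∑-update (suc n) k (bounded-term (suc k) n) (bounded-term k n)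
                                                                                (s≤s k≤n) (λ i _ → bounded-term-suc k n i) ⟩
      ∑[ i < suc n ] bounded-term k n i + (new - old)                      ≡⟨ cong₂ (λ s d → s + d) (sym (bounded-suc k n)) new-old ⟩
      bounded k (suc n) + indicator (S (suc k)) * shift (suc k) (bounded (suc k)) (suc n) ∎
      where
      open ≡-Reasoning
      new : ℤ
      new = bounded-term (suc k) n k
      old : ℤ
      old = bounded-term k n k
      new-old : new - old ≡ indicator (S (suc k)) * shift k (bounded (suc k)) n
      new-old = begin
        indicator (S (suc k) ∧ (suc k ≤ᵇ suc k)) * bounded (suc k) (n ∸ k) - indicator (S (suc k) ∧ (suc k ≤ᵇ k)) * bounded (suc k) (n ∸ k)
          ≡⟨ cong₂ (λ x y → indicator (S (suc k) ∧ x) * bounded (suc k) (n ∸ k) - indicator (S (suc k) ∧ y) * bounded (suc k) (n ∸ k))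
                   (≤ᵇ-true (ℕ.≤-refl {suc k})) (≤ᵇ-false (ℕ.≤-refl {suc k})) ⟩
        indicator (S (suc k) ∧ true) * bounded (suc k) (n ∸ k) - indicator (S (suc k) ∧ false) * bounded (suc k) (n ∸ k)
          ≡⟨ cong₂ (λ x y → indicator x * bounded (suc k) (n ∸ k) - indicator y * bounded (suc k) (n ∸ k))
                   (Bool.∧-identityʳ (S (suc k))) (Bool.∧-zeroʳ (S (suc k))) ⟩
        indicator (S (suc k)) * bounded (suc k) (n ∸ k) - 0ℤ
          ≡⟨ ℤ.+-identityʳ _ ⟩
        indicator (S (suc k)) * bounded (suc k) (n ∸ k)
          ≡⟨ cong (indicator (S (suc k)) *_) (shift-≥ k (bounded (suc k)) n k≤n) ⟨
        indicator (S (suc k)) * shift k (bounded (suc k)) n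
          ∎
    ... | inj₂ n<k = begin
      bounded (suc k) (suc n)                      ≡⟨ bounded-suc (suc k) n ⟩
      ∑[ i < suc n ] bounded-term (suc k) n i      ≡⟨ ∑-cong (suc n) (λ i i≤n → bounded-term-suc k n i
                                                        (λ i≡k → ℕ.<-irrefl i≡k (ℕ.≤-<-trans (ℕ.≤-pred i≤n) n<k))) ⟩
      ∑[ i < suc n ] bounded-term k n i            ≡⟨ bounded-suc k n ⟨
      bounded k (suc n)                            ≡⟨ ℤ.+-identityʳ _ ⟨
      bounded k (suc n) + 0ℤ                       ≡⟨ cong (bounded k (suc n) +_) (trans (cong (indicator (S (suc k)) *_)
                                                        (shift-< k (bounded (suc k)) n n<k)) (ℤ.*-zeroʳ (indicator (S (suc k))))) ⟨
      bounded k (suc n) + indicator (S (suc k)) * shift (suc k) (bounded (suc k)) (suc n) ∎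
      where open ≡-Reasoning

    allowedFactor forbiddenFactor : ℕ → Series
    allowedFactor k = if S (suc k) then 1-q^ suc k else 𝟙
    forbiddenFactor k = if S (suc k) then 𝟙 else 1-q^ suc k

    bounded-⊛-allowedFactor : ∀ k → bounded (suc k) ⊛ allowedFactor k ≈ bounded k
    bounded-⊛-allowedFactor k with S (suc k) in S[1+k]
    ... | true = ≈-trans (expand (bounded (suc k)) (q^ suc k)) (mk≈ λ n → begin
          bounded (suc k) n - (q^ suc k ⊛ bounded (suc k)) n
            ≡⟨ cong₂ _-_ (bounded-step k n) (at (q^-⊛ (suc k) (bounded (suc k))) n) ⟩
          bounded k n + indicator (S (suc k)) * shift (suc k) (bounded (suc k)) n - shift (suc k) (bounded (suc k)) n
            ≡⟨ cong (λ b → bounded k n + indicator b * shift (suc k) (bounded (suc k)) n - shift (suc k) (bounded (suc k)) n) S[1+k] ⟩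
          bounded k n + 1ℤ * shift (suc k) (bounded (suc k)) n - shift (suc k) (bounded (suc k)) n
            ≡⟨ cancel (bounded k n) (shift (suc k) (bounded (suc k)) n) ⟩
          bounded k n
            ∎)
      where
      open ≡-Reasoning
      expand : ∀ A P → A ⊛ (𝟙 ⊕ ⊝ P) ≈ A ⊕ ⊝ (P ⊛ A)
      expand = solve 2 (λ A P → A :* (con 1ℤ :+ :- P) := A :+ :- (P :* A)) ≈-refl
      cancel : ∀ x y → x + 1ℤ * y - y ≡ x
      cancel = solve-∀
    ... | false = ≈-trans (⊛-identityʳ (bounded (suc k))) (mk≈ λ n →
          trans (bounded-step k n)
                (trans (cong (λ b → bounded k n + indicator b * shift (suc k) (bounded (suc k)) n) S[1+k]) (ℤ.+-identityʳ _)))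

    bounded-⊛-∏-allowedFactor : ∀ k → bounded k ⊛ ∏ allowedFactor k ≈ 𝟙
    bounded-⊛-∏-allowedFactor zero = ≈-trans (⊛-identityʳ (bounded 0)) bounded-zero
    bounded-⊛-∏-allowedFactor (suc k) = begin
      bounded (suc k) ⊛ (∏ allowedFactor k ⊛ allowedFactor k)   ≈⟨ rotate (bounded (suc k)) (∏ allowedFactor k) (allowedFactor k) ⟩
      (bounded (suc k) ⊛ allowedFactor k) ⊛ ∏ allowedFactor k   ≈⟨ ⊛-congʳ (∏ allowedFactor k) (bounded-⊛-allowedFactor k) ⟩
      bounded k ⊛ ∏ allowedFactor k                             ≈⟨ bounded-⊛-∏-allowedFactor k ⟩
      𝟙                                                         ∎
      where
      open ≈-Reasoning
      rotate : ∀ A B C → A ⊛ (B ⊛ C) ≈ (A ⊛ C) ⊛ B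
      rotate = solve 3 (λ A B C → A :* (B :* C) := (A :* C) :* B) ≈-refl

    allowedFactor-⊛-forbiddenFactor : ∀ k → allowedFactor k ⊛ forbiddenFactor k ≈ 1-q^ suc k
    allowedFactor-⊛-forbiddenFactor k with S (suc k)
    ... | true = ⊛-identityʳ (1-q^ suc k)
    ... | false = ⊛-identityˡ (1-q^ suc k)

    bounded-⊛-euler : ∀ k → bounded k ⊛ ∏ (λ i → 1-q^ suc i) k ≈ ∏ forbiddenFactor k
    bounded-⊛-euler k = begin
      bounded k ⊛ ∏ (λ i → 1-q^ suc i) k
        ≈⟨ ⊛-congˡ (bounded k) (∏-cong k (λ i _ → allowedFactor-⊛-forbiddenFactor i)) ⟨
      bounded k ⊛ ∏ (λ i → allowedFactor i ⊛ forbiddenFactor i) k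
        ≈⟨ ⊛-congˡ (bounded k) (∏-⊛ allowedFactor forbiddenFactor k) ⟨
      bounded k ⊛ (∏ allowedFactor k ⊛ ∏ forbiddenFactor k)
        ≈⟨ ⊛-assoc (bounded k) (∏ allowedFactor k) (∏ forbiddenFactor k) ⟨
      (bounded k ⊛ ∏ allowedFactor k) ⊛ ∏ forbiddenFactor k
        ≈⟨ ⊛-congʳ (∏ forbiddenFactor k) (bounded-⊛-∏-allowedFactor k) ⟩
      𝟙 ⊛ ∏ forbiddenFactor k
        ≈⟨ ⊛-identityˡ (∏ forbiddenFactor k) ⟩
      ∏ forbiddenFactor k
        ∎
      where
      open ≈-Reasoning

    partitionCount-bounded : ∀ k n → n ≤ k → ℤ.+ length (partitions S n) ≡ bounded k n
    partitionCount-bounded k n n≤k = trans (length-sumBy (partitions S n)) (sym (bounded-≥ k n n≤k))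

module ProductIdentities where

  open import Data.Nat as ℕ using (ℕ; zero; suc; _%_)
  import Data.Nat.Properties as ℕ
  open import Data.Nat.DivMod using ([m+kn]%n≡m%n)
  open import Data.Nat.Tactic.RingSolver using (solve-∀)
  open import Data.Bool using (_∨_; if_then_else_)
  open import Data.Integer using (1ℤ)
  open import Relation.Binary.PropositionalEquality
  open import Defs using (isPm1mod5)
  open PowerSeries
  open TripleProduct
  open Partitions

  module Euler = FiniteJacobi 1 2
  module RogersRamanujan = FiniteJacobi 2 3
  open RestrictedPartitions isPm1mod5 using (forbiddenFactor)

  euler : ℕ → Series
  euler = ∏ (λ i → 1-q^ suc i)

  1-q^-≡ : ∀ {k l} → k ≡ l → 1-q^ k ≈ 1-q^ l
  1-q^-≡ refl = ≈-refl

  tripleProduct-euler : ∀ N → Euler.tripleProduct N ≈ euler (3 ℕ.* N)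
  tripleProduct-euler zero = Euler.tripleProduct-zero
  tripleProduct-euler (suc N) = begin
    Euler.tripleProduct (suc N)
      ≈⟨ Euler.tripleProduct-suc N ⟩
    Euler.tripleProduct N ⊛ (Euler.bFactor N ⊛ (Euler.cFactor N ⊛ Euler.1-t^ suc N))
      ≈⟨ ⊛-cong (tripleProduct-euler N) block ⟩
    euler (3 ℕ.* N) ⊛ ∏ (λ j → 1-q^ suc (3 ℕ.* N ℕ.+ j)) 3
      ≈⟨ ∏-+ (λ i → 1-q^ suc i) (3 ℕ.* N) 3 ⟨
    euler (3 ℕ.* N ℕ.+ 3)
      ≡⟨ cong euler (trans (ℕ.+-comm (3 ℕ.* N) 3) (sym (ℕ.*-suc 3 N))) ⟩
    euler (3 ℕ.* suc N)
      ∎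
    where
    open ≈-Reasoning
    block : Euler.bFactor N ⊛ (Euler.cFactor N ⊛ Euler.1-t^ suc N) ≈ ∏ (λ j → 1-q^ suc (3 ℕ.* N ℕ.+ j)) 3
    block = ≈-trans (⊛-cong (1-q^-≡ (e₁ N)) (⊛-cong (1-q^-≡ (e₂ N)) (1-q^-≡ (e₃ N))))
                    (reassociate (1-q^ suc (3 ℕ.* N ℕ.+ 0)) (1-q^ suc (3 ℕ.* N ℕ.+ 1)) (1-q^ suc (3 ℕ.* N ℕ.+ 2)))
      where
      reassociate : ∀ A B C → A ⊛ (B ⊛ C) ≈ ((𝟙 ⊛ A) ⊛ B) ⊛ C
      reassociate = solve 3 (λ A B C → A :* (B :* C) := ((con 1ℤ :* A) :* B) :* C) ≈-refl
      e₁ : ∀ N → 1 ℕ.+ N ℕ.* 3 ≡ suc (3 ℕ.* N ℕ.+ 0)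
      e₁ = solve-∀
      e₂ : ∀ N → 2 ℕ.+ N ℕ.* 3 ≡ suc (3 ℕ.* N ℕ.+ 1)
      e₂ = solve-∀
      e₃ : ∀ N → suc N ℕ.* 3 ≡ suc (3 ℕ.* N ℕ.+ 2)
      e₃ = solve-∀

  forbiddenFactor-periodic : ∀ N j → forbiddenFactor (5 ℕ.* N ℕ.+ j) ≡ (if isPm1mod5 (suc j) then 𝟙 else 1-q^ suc (5 ℕ.* N ℕ.+ j))
  forbiddenFactor-periodic N j = cong (λ b → if b then 𝟙 else 1-q^ suc (5 ℕ.* N ℕ.+ j)) residue
    where
    shape : ∀ N j → suc (5 ℕ.* N ℕ.+ j) ≡ suc j ℕ.+ N ℕ.* 5
    shape = solve-∀
    residue : isPm1mod5 (suc (5 ℕ.* N ℕ.+ j)) ≡ isPm1mod5 (suc j)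
    residue = cong (λ r → (r ℕ.≡ᵇ 1) ∨ (r ℕ.≡ᵇ 4)) (trans (cong (_% 5) (shape N j)) ([m+kn]%n≡m%n (suc j) N 5))

  tripleProduct-rogersRamanujan : ∀ N → RogersRamanujan.tripleProduct N ≈ ∏ forbiddenFactor (5 ℕ.* N)
  tripleProduct-rogersRamanujan zero = RogersRamanujan.tripleProduct-zero
  tripleProduct-rogersRamanujan (suc N) = begin
    RogersRamanujan.tripleProduct (suc N)
      ≈⟨ RogersRamanujan.tripleProduct-suc N ⟩
    RogersRamanujan.tripleProduct N ⊛ (RogersRamanujan.bFactor N ⊛ (RogersRamanujan.cFactor N ⊛ RogersRamanujan.1-t^ suc N))
      ≈⟨ ⊛-cong (tripleProduct-rogersRamanujan N) block ⟩
    ∏ forbiddenFactor (5 ℕ.* N) ⊛ ∏ (λ j → forbiddenFactor (5 ℕ.* N ℕ.+ j)) 5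
      ≈⟨ ∏-+ forbiddenFactor (5 ℕ.* N) 5 ⟨
    ∏ forbiddenFactor (5 ℕ.* N ℕ.+ 5)
      ≡⟨ cong (∏ forbiddenFactor) (trans (ℕ.+-comm (5 ℕ.* N) 5) (sym (ℕ.*-suc 5 N))) ⟩
    ∏ forbiddenFactor (5 ℕ.* suc N)
      ∎
    where
    open ≈-Reasoning
    block : RogersRamanujan.bFactor N ⊛ (RogersRamanujan.cFactor N ⊛ RogersRamanujan.1-t^ suc N)
            ≈ ∏ (λ j → forbiddenFactor (5 ℕ.* N ℕ.+ j)) 5
    block = begin
      RogersRamanujan.bFactor N ⊛ (RogersRamanujan.cFactor N ⊛ RogersRamanujan.1-t^ suc N)
        ≈⟨ ⊛-cong (1-q^-≡ (e₁ N)) (⊛-cong (1-q^-≡ (e₂ N)) (1-q^-≡ (e₃ N))) ⟩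
      1-q^ suc (5 ℕ.* N ℕ.+ 1) ⊛ (1-q^ suc (5 ℕ.* N ℕ.+ 2) ⊛ 1-q^ suc (5 ℕ.* N ℕ.+ 4))
        ≈⟨ reassociate (1-q^ suc (5 ℕ.* N ℕ.+ 1)) (1-q^ suc (5 ℕ.* N ℕ.+ 2)) (1-q^ suc (5 ℕ.* N ℕ.+ 4)) ⟩
      ∏ (λ j → if isPm1mod5 (suc j) then 𝟙 else 1-q^ suc (5 ℕ.* N ℕ.+ j)) 5
        ≈⟨ ∏-cong 5 (λ j _ → ≡⇒≈ (forbiddenFactor-periodic N j)) ⟨
      ∏ (λ j → forbiddenFactor (5 ℕ.* N ℕ.+ j)) 5
        ∎
      where
      reassociate : ∀ A B C → A ⊛ (B ⊛ C) ≈ ((((𝟙 ⊛ 𝟙) ⊛ A) ⊛ B) ⊛ 𝟙) ⊛ C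
      reassociate = solve 3 (λ A B C → A :* (B :* C) := ((((con 1ℤ :* con 1ℤ) :* A) :* B) :* con 1ℤ) :* C) ≈-refl
      e₁ : ∀ N → 2 ℕ.+ N ℕ.* 5 ≡ suc (5 ℕ.* N ℕ.+ 1)
      e₁ = solve-∀
      e₂ : ∀ N → 3 ℕ.+ N ℕ.* 5 ≡ suc (5 ℕ.* N ℕ.+ 2)
      e₂ = solve-∀
      e₃ : ∀ N → suc N ℕ.* 5 ≡ suc (5 ℕ.* N ℕ.+ 4)
      e₃ = solve-∀

module Decoding where

  open import Data.Nat as ℕ using (ℕ; zero; suc; _∸_; _≤_; _<_; _≡ᵇ_; _%_; z≤n; s≤s)
  import Data.Nat.Properties as ℕ
  open import Data.Nat.DivMod using ([m+kn]%n≡m%n)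
  open import Data.Nat.Tactic.RingSolver using (solve-∀)
  open import Data.Integer as ℤ using (-_; 1ℤ)
  open import Data.Bool using (Bool; true; false; if_then_else_; _∧_; _∨_; T)
  import Data.Bool.Properties as Bool
  open import Data.List using (applyUpTo; foldr)
  open import Data.Product using (_×_; _,_; ∃)
  open import Data.Sum using (_⊎_; inj₁; inj₂)
  open import Data.Empty using (⊥)
  open import Relation.Binary.PropositionalEquality
  open import Function using (_∘_; Equivalence)
  open import Defs
  open TripleProduct
  open Compositions using (hatSign; module SignedCompositions)

  -- anyBelow n p is anyOf (λ i → i) n p; the general f lets the induction on n go through.
  anyOf : (ℕ → ℕ) → ℕ → (ℕ → Bool) → Bool
  anyOf f n p = foldr (λ k b → p k ∨ b) false (applyUpTo f n)

  anyOf-intro : ∀ f n p k → k < n → p (f k) ≡ true → anyOf f n p ≡ true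
  anyOf-intro f (suc n) p zero _ pf0 = cong (_∨ anyOf (f ∘ suc) n p) pf0
  anyOf-intro f (suc n) p (suc k) (s≤s k<n) pfk =
    trans (cong (p (f 0) ∨_) (anyOf-intro (f ∘ suc) n p k k<n pfk)) (Bool.∨-zeroʳ (p (f 0)))

  anyOf-elim : ∀ f n p → anyOf f n p ≡ true → ∃ λ k → k < n × p (f k) ≡ true
  anyOf-elim f (suc n) p any with p (f 0) in pf0
  ... | true = 0 , s≤s z≤n , pf0
  ... | false with anyOf-elim (f ∘ suc) n p any
  ...   | k , k<n , pfk = suc k , s≤s k<n , pfk

  anyBelow-intro : ∀ n p k → k < n → p k ≡ true → anyBelow n p ≡ true
  anyBelow-intro = anyOf-intro (λ i → i)

  anyBelow-elim : ∀ n p → anyBelow n p ≡ true → ∃ λ k → k < n × p k ≡ true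
  anyBelow-elim = anyOf-elim (λ i → i)

  ≡ᵇ⇒≡ : ∀ {m n} → (m ≡ᵇ n) ≡ true → m ≡ n
  ≡ᵇ⇒≡ {m} {n} m≡ᵇn = ℕ.≡ᵇ⇒≡ m n (subst T (sym m≡ᵇn) _)

  ≡⇒≡ᵇ : ∀ {m n} → m ≡ n → (m ≡ᵇ n) ≡ true
  ≡⇒≡ᵇ {m} {n} m≡n = Equivalence.to Bool.T-≡ (ℕ.≡⇒≡ᵇ m n m≡n)

  ∨-true : ∀ x y → (x ∨ y) ≡ true → x ≡ true ⊎ y ≡ true
  ∨-true true y _ = inj₁ refl
  ∨-true false y y≡true = inj₂ y≡true

  parity : ∀ m → ∃ λ k → m ≡ 2 ℕ.* k ⊎ m ≡ suc (2 ℕ.* k)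
  parity zero = 0 , inj₁ refl
  parity (suc m) with parity m
  ... | k , inj₁ m≡2k = k , inj₂ (cong suc m≡2k)
  ... | k , inj₂ m≡1+2k = suc k , inj₁ (trans (cong suc m≡1+2k) (double-suc k))
    where
    double-suc : ∀ k → suc (suc (2 ℕ.* k)) ≡ 2 ℕ.* suc k
    double-suc = solve-∀

  mod2 : ∀ r k → (r ℕ.+ 2 ℕ.* k) % 2 ≡ r % 2
  mod2 r k = trans (cong (_% 2) (cong (r ℕ.+_) (ℕ.*-comm 2 k))) ([m+kn]%n≡m%n r k 2)

  signPow-even : ∀ k → signPow (2 ℕ.* k) ≡ 1ℤ
  signPow-even k = trans (cong signPow (double k)) (trans (signPow-+ k k) (signPow-square k))
    where
    double : ∀ k → 2 ℕ.* k ≡ k ℕ.+ k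
    double = solve-∀

  triangle-double : ∀ b c m → FiniteJacobi.triangle b c m ℕ.* 2 ℕ.+ m ≡ m ℕ.* m
  triangle-double b c zero = refl
  triangle-double b c (suc m) = begin
    (t ℕ.+ m) ℕ.* 2 ℕ.+ suc m     ≡⟨ regroup t m ⟩
    t ℕ.* 2 ℕ.+ m ℕ.+ suc (m ℕ.+ m) ≡⟨ cong (ℕ._+ suc (m ℕ.+ m)) (triangle-double b c m) ⟩
    m ℕ.* m ℕ.+ suc (m ℕ.+ m)     ≡⟨ square-suc m ⟩
    suc m ℕ.* suc m               ∎
    where
    open ≡-Reasoning
    t : ℕ
    t = FiniteJacobi.triangle b c m
    regroup : ∀ t m → (t ℕ.+ m) ℕ.* 2 ℕ.+ suc m ≡ t ℕ.* 2 ℕ.+ m ℕ.+ suc (m ℕ.+ m)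
    regroup = solve-∀
    square-suc : ∀ m → m ℕ.* m ℕ.+ suc (m ℕ.+ m) ≡ suc m ℕ.* suc m
    square-suc = solve-∀

  module PentagonalNumbers where

    open FiniteJacobi 1 2 using (eP; eN; triangle; ThetaExponent)
    open FiniteJacobi.Evaluation 1 2 (s≤s z≤n) (s≤s (s≤s z≤n)) using (ThetaExponent-≤; ThetaExponent-unique)

    double-eP : ∀ m → 2 ℕ.* eP m ≡ m ℕ.* (3 ℕ.* m ∸ 1)
    double-eP zero = refl
    double-eP (suc k) = ℕ.+-cancelʳ-≡ (suc k) _ _ (begin
      2 ℕ.* eP (suc k) ℕ.+ suc k                    ≡⟨ expand (triangle (suc k)) k ⟩
      3 ℕ.* (triangle (suc k) ℕ.* 2 ℕ.+ suc k)      ≡⟨ cong (3 ℕ.*_) (triangle-double 1 2 (suc k)) ⟩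
      3 ℕ.* (suc k ℕ.* suc k)                       ≡⟨ square k ⟩
      suc k ℕ.* (2 ℕ.+ 3 ℕ.* k) ℕ.+ suc k           ≡⟨ cong (λ x → suc k ℕ.* x ℕ.+ suc k) (ℕ.m+n∸m≡n 1 (2 ℕ.+ 3 ℕ.* k)) ⟨
      suc k ℕ.* (1 ℕ.+ (2 ℕ.+ 3 ℕ.* k) ∸ 1) ℕ.+ suc k ≡⟨ cong (λ x → suc k ℕ.* (x ∸ 1) ℕ.+ suc k) (triple-suc k) ⟩
      suc k ℕ.* (3 ℕ.* suc k ∸ 1) ℕ.+ suc k         ∎)
      where
      open ≡-Reasoning
      expand : ∀ t k → 2 ℕ.* (suc k ℕ.* 1 ℕ.+ t ℕ.* 3) ℕ.+ suc k ≡ 3 ℕ.* (t ℕ.* 2 ℕ.+ suc k)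
      expand = solve-∀
      square : ∀ k → 3 ℕ.* (suc k ℕ.* suc k) ≡ suc k ℕ.* (2 ℕ.+ 3 ℕ.* k) ℕ.+ suc k
      square = solve-∀
      triple-suc : ∀ k → 1 ℕ.+ (2 ℕ.+ 3 ℕ.* k) ≡ 3 ℕ.* suc k
      triple-suc = solve-∀

    double-eN : ∀ m → 2 ℕ.* eN m ≡ m ℕ.* (3 ℕ.* m ℕ.+ 1)
    double-eN m = begin
      2 ℕ.* eN m                       ≡⟨ expand (triangle m) m ⟩
      3 ℕ.* (triangle m ℕ.* 2 ℕ.+ m) ℕ.+ m ≡⟨ cong (λ x → 3 ℕ.* x ℕ.+ m) (triangle-double 1 2 m) ⟩
      3 ℕ.* (m ℕ.* m) ℕ.+ m            ≡⟨ factor m ⟩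
      m ℕ.* (3 ℕ.* m ℕ.+ 1)            ∎
      where
      open ≡-Reasoning
      expand : ∀ t m → 2 ℕ.* (m ℕ.* 2 ℕ.+ t ℕ.* 3) ≡ 3 ℕ.* (t ℕ.* 2 ℕ.+ m) ℕ.+ m
      expand = solve-∀
      factor : ∀ m → 3 ℕ.* (m ℕ.* m) ℕ.+ m ≡ m ℕ.* (3 ℕ.* m ℕ.+ 1)
      factor = solve-∀

    isPentagonal : ℕ → ℕ → Bool
    isPentagonal m d = (2 ℕ.* d ≡ᵇ m ℕ.* (3 ℕ.* m ∸ 1)) ∨ (2 ℕ.* d ≡ᵇ m ℕ.* (3 ℕ.* m ℕ.+ 1))

    isPentagonal⇒ThetaExponent : ∀ m d → isPentagonal m d ≡ true → ThetaExponent m d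
    isPentagonal⇒ThetaExponent m d test with ∨-true _ _ test
    ... | inj₁ minus = inj₁ (ℕ.*-cancelˡ-≡ d (eP m) 2 (trans (≡ᵇ⇒≡ minus) (sym (double-eP m))))
    ... | inj₂ plus with m
    ...   | zero = inj₁ (ℕ.*-cancelˡ-≡ d 0 2 (≡ᵇ⇒≡ plus))
    ...   | suc k = inj₂ (s≤s z≤n , ℕ.*-cancelˡ-≡ d (eN (suc k)) 2 (trans (≡ᵇ⇒≡ plus) (sym (double-eN (suc k)))))

    ThetaExponent⇒isPentagonal : ∀ m d → ThetaExponent m d → isPentagonal m d ≡ true
    ThetaExponent⇒isPentagonal m d (inj₁ d≡eP) =
      cong (_∨ (2 ℕ.* d ≡ᵇ m ℕ.* (3 ℕ.* m ℕ.+ 1))) (≡⇒≡ᵇ (trans (cong (2 ℕ.*_) d≡eP) (double-eP m)))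
    ThetaExponent⇒isPentagonal m d (inj₂ (_ , d≡eN)) =
      trans (cong ((2 ℕ.* d ≡ᵇ m ℕ.* (3 ℕ.* m ∸ 1)) ∨_) (≡⇒≡ᵇ (trans (cong (2 ℕ.*_) d≡eN) (double-eN m)))) (Bool.∨-zeroʳ _)

    isP5-intro : ∀ m d → ThetaExponent m d → isP5 d ≡ true
    isP5-intro m d e = anyBelow-intro (suc d) (λ m → isPentagonal m d) m (s≤s (ThetaExponent-≤ e)) (ThetaExponent⇒isPentagonal m d e)

    isP5-elim : ∀ d → isP5 d ≡ true → ∃ λ m → ThetaExponent m d
    isP5-elim d test with anyBelow-elim (suc d) (λ m → isPentagonal m d) test
    ... | m , _ , pm = m , isPentagonal⇒ThetaExponent m d pm

    isPhat-exponent : ∀ m d → ThetaExponent m d → isPhat d ≡ (m % 2 ≡ᵇ 0)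
    isPhat-exponent m d e with m % 2 ≡ᵇ 0 in m-parity
    ... | true = anyBelow-intro (suc d) (λ m → (m % 2 ≡ᵇ 0) ∧ isPentagonal m d) m (s≤s (ThetaExponent-≤ e))
                   (trans (cong (_∧ isPentagonal m d) m-parity) (ThetaExponent⇒isPentagonal m d e))
    ... | false = Bool.¬-not not-hat
      where
      not-hat : isPhat d ≢ true
      not-hat hat with anyBelow-elim (suc d) (λ m → (m % 2 ≡ᵇ 0) ∧ isPentagonal m d) hat
      ... | m′ , _ , test with (m′ % 2 ≡ᵇ 0) in m′-even
      ...   | true with ThetaExponent-unique e (isPentagonal⇒ThetaExponent m′ d test)
      ...     | refl with trans (sym m′-even) m-parity
      ...       | ()

    hatSign-exponent : ∀ m d → ThetaExponent m d → - hatSign d ≡ signPow m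
    hatSign-exponent m d e with parity m
    ... | k , inj₁ refl = begin
      - hatSign d
        ≡⟨ cong (λ h → - (if h then - 1ℤ else 1ℤ)) (isPhat-exponent (2 ℕ.* k) d e) ⟩
      - (if (2 ℕ.* k) % 2 ≡ᵇ 0 then - 1ℤ else 1ℤ)
        ≡⟨ cong (λ r → - (if r ≡ᵇ 0 then - 1ℤ else 1ℤ)) (mod2 0 k) ⟩
      1ℤ
        ≡⟨ signPow-even k ⟨
      signPow (2 ℕ.* k)
        ∎
      where open ≡-Reasoning
    ... | k , inj₂ refl = begin
      - hatSign d
        ≡⟨ cong (λ h → - (if h then - 1ℤ else 1ℤ)) (isPhat-exponent (suc (2 ℕ.* k)) d e) ⟩
      - (if suc (2 ℕ.* k) % 2 ≡ᵇ 0 then - 1ℤ else 1ℤ)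
        ≡⟨ cong (λ r → - (if r ≡ᵇ 0 then - 1ℤ else 1ℤ)) (mod2 1 k) ⟩
      - 1ℤ
        ≡⟨ cong -_ (signPow-even k) ⟨
      signPow (suc (2 ℕ.* k))
        ∎
      where open ≡-Reasoning

    open SignedCompositions isP5 using (denominator)
    open FiniteJacobi 1 2 using (tripleProduct)
    open FiniteJacobi.Evaluation 1 2 (s≤s z≤n) (s≤s (s≤s z≤n)) using (tripleProduct-exponent; tripleProduct-gap)

    denominator-coeff : ∀ N d → d ≤ N → denominator d ≡ tripleProduct N d
    denominator-coeff N zero _ = sym (tripleProduct-exponent N 0 0 z≤n (inj₁ refl))
    denominator-coeff N (suc d) d<N with isP5 (suc d) in member
    ... | true with isP5-elim (suc d) member
    ...   | m , e = trans (hatSign-exponent m (suc d) e) (sym (tripleProduct-exponent N (suc d) m d<N e))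
    denominator-coeff N (suc d) d<N | false =
      sym (tripleProduct-gap N (suc d) d<N λ m _ e → Bool.not-¬ member (isP5-intro m (suc d) e))

  module RogersRamanujanExponents where

    open FiniteJacobi 2 3 using (eP; eN; triangle; ThetaExponent; tripleProduct)
    open FiniteJacobi.Evaluation 2 3 (s≤s z≤n) (s≤s (s≤s (s≤s z≤n)))
      using (ThetaExponent-≤; tripleProduct-exponent; tripleProduct-gap)

    triangle-even : ∀ j → triangle (2 ℕ.* j) ℕ.+ j ≡ 2 ℕ.* (j ℕ.* j)
    triangle-even j = ℕ.*-cancelʳ-≡ _ _ 2 (begin
      (triangle (2 ℕ.* j) ℕ.+ j) ℕ.* 2      ≡⟨ distrib (triangle (2 ℕ.* j)) j ⟩
      triangle (2 ℕ.* j) ℕ.* 2 ℕ.+ 2 ℕ.* j  ≡⟨ triangle-double 2 3 (2 ℕ.* j) ⟩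
      2 ℕ.* j ℕ.* (2 ℕ.* j)                 ≡⟨ square j ⟩
      2 ℕ.* (j ℕ.* j) ℕ.* 2                 ∎)
      where
      open ≡-Reasoning
      distrib : ∀ t j → (t ℕ.+ j) ℕ.* 2 ≡ t ℕ.* 2 ℕ.+ 2 ℕ.* j
      distrib = solve-∀
      square : ∀ j → 2 ℕ.* j ℕ.* (2 ℕ.* j) ≡ 2 ℕ.* (j ℕ.* j) ℕ.* 2
      square = solve-∀

    triangle-odd : ∀ j → triangle (suc (2 ℕ.* j)) ≡ 2 ℕ.* (j ℕ.* j) ℕ.+ j
    triangle-odd j = trans (regroup (triangle (2 ℕ.* j)) j) (cong (ℕ._+ j) (triangle-even j))
      where
      regroup : ∀ t j → t ℕ.+ 2 ℕ.* j ≡ t ℕ.+ j ℕ.+ j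
      regroup = solve-∀

    eP-even : ∀ j → eP (2 ℕ.* j) ℕ.+ j ≡ 10 ℕ.* j ℕ.* j
    eP-even j = trans (expand (triangle (2 ℕ.* j)) j) (trans (cong (5 ℕ.*_) (triangle-even j)) (tenfold j))
      where
      expand : ∀ t j → 2 ℕ.* j ℕ.* 2 ℕ.+ t ℕ.* 5 ℕ.+ j ≡ 5 ℕ.* (t ℕ.+ j)
      expand = solve-∀
      tenfold : ∀ j → 5 ℕ.* (2 ℕ.* (j ℕ.* j)) ≡ 10 ℕ.* j ℕ.* j
      tenfold = solve-∀

    eN-even : ∀ j → eN (2 ℕ.* j) ≡ 10 ℕ.* j ℕ.* j ℕ.+ j
    eN-even j = trans (expand (triangle (2 ℕ.* j)) j) (trans (cong (λ x → 5 ℕ.* x ℕ.+ j) (triangle-even j)) (tenfold j))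
      where
      expand : ∀ t j → 2 ℕ.* j ℕ.* 3 ℕ.+ t ℕ.* 5 ≡ 5 ℕ.* (t ℕ.+ j) ℕ.+ j
      expand = solve-∀
      tenfold : ∀ j → 5 ℕ.* (2 ℕ.* (j ℕ.* j)) ℕ.+ j ≡ 10 ℕ.* j ℕ.* j ℕ.+ j
      tenfold = solve-∀

    eP-odd : ∀ j → eP (suc (2 ℕ.* j)) ≡ 10 ℕ.* j ℕ.* j ℕ.+ 9 ℕ.* j ℕ.+ 2
    eP-odd j = trans (cong (λ x → suc (2 ℕ.* j) ℕ.* 2 ℕ.+ x ℕ.* 5) (triangle-odd j)) (expand j)
      where
      expand : ∀ j → suc (2 ℕ.* j) ℕ.* 2 ℕ.+ (2 ℕ.* (j ℕ.* j) ℕ.+ j) ℕ.* 5 ≡ 10 ℕ.* j ℕ.* j ℕ.+ 9 ℕ.* j ℕ.+ 2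
      expand = solve-∀

    eN-odd : ∀ j → eN (suc (2 ℕ.* j)) ℕ.+ 9 ℕ.* suc j ≡ 10 ℕ.* suc j ℕ.* suc j ℕ.+ 2
    eN-odd j = trans (cong (λ x → suc (2 ℕ.* j) ℕ.* 3 ℕ.+ x ℕ.* 5 ℕ.+ 9 ℕ.* suc j) (triangle-odd j)) (expand j)
      where
      expand : ∀ j → suc (2 ℕ.* j) ℕ.* 3 ℕ.+ (2 ℕ.* (j ℕ.* j) ℕ.+ j) ℕ.* 5 ℕ.+ 9 ℕ.* suc j ≡ 10 ℕ.* suc j ℕ.* suc j ℕ.+ 2
      expand = solve-∀

    plusTest minusTest : ℕ → ℕ → Bool
    plusTest j d = (d ℕ.+ j ≡ᵇ 10 ℕ.* j ℕ.* j) ∨ (d ≡ᵇ 10 ℕ.* j ℕ.* j ℕ.+ j)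
    minusTest j d = (d ℕ.+ 9 ℕ.* j ≡ᵇ 10 ℕ.* j ℕ.* j ℕ.+ 2) ∨ (d ≡ᵇ 10 ℕ.* j ℕ.* j ℕ.+ 9 ℕ.* j ℕ.+ 2)

    plusTest⇒ThetaExponent : ∀ j d → plusTest j d ≡ true → ThetaExponent (2 ℕ.* j) d
    plusTest⇒ThetaExponent j d test with ∨-true _ _ test
    ... | inj₁ first = inj₁ (ℕ.+-cancelʳ-≡ j d _ (trans (≡ᵇ⇒≡ first) (sym (eP-even j))))
    ... | inj₂ second with j
    ...   | zero = inj₁ (≡ᵇ⇒≡ second)
    ...   | suc k = inj₂ (s≤s z≤n , trans (≡ᵇ⇒≡ second) (sym (eN-even (suc k))))

    minusTest⇒ThetaExponent : ∀ j d → minusTest j d ≡ true → ∃ λ k → ThetaExponent (suc (2 ℕ.* k)) d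
    minusTest⇒ThetaExponent j d test with ∨-true _ _ test
    ... | inj₂ second = j , inj₁ (trans (≡ᵇ⇒≡ second) (sym (eP-odd j)))
    ... | inj₁ first with j
    ...   | zero = 0 , inj₁ (trans (sym (ℕ.+-identityʳ d)) (≡ᵇ⇒≡ first))
    ...   | suc k = k , inj₂ (s≤s z≤n , ℕ.+-cancelʳ-≡ (9 ℕ.* suc k) d _ (trans (≡ᵇ⇒≡ first) (sym (eN-odd k))))

    ThetaExponent-even⇒isPlus : ∀ k d → ThetaExponent (2 ℕ.* k) d → isPlus d ≡ true
    ThetaExponent-even⇒isPlus k d e =
      anyBelow-intro (suc d) (λ j → plusTest j d) k (s≤s (ℕ.≤-trans (ℕ.m≤n*m k 2) (ThetaExponent-≤ e))) (test e)
      where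
      test : ThetaExponent (2 ℕ.* k) d → plusTest k d ≡ true
      test (inj₁ d≡eP) = cong (_∨ (d ≡ᵇ 10 ℕ.* k ℕ.* k ℕ.+ k)) (≡⇒≡ᵇ (trans (cong (ℕ._+ k) d≡eP) (eP-even k)))
      test (inj₂ (_ , d≡eN)) = trans (cong ((d ℕ.+ k ≡ᵇ 10 ℕ.* k ℕ.* k) ∨_) (≡⇒≡ᵇ (trans d≡eN (eN-even k)))) (Bool.∨-zeroʳ _)

    ThetaExponent-odd⇒isMinus : ∀ k d → ThetaExponent (suc (2 ℕ.* k)) d → isMinus d ≡ true
    ThetaExponent-odd⇒isMinus k d e@(inj₁ d≡eP) =
      anyBelow-intro (suc d) (λ j → minusTest j d) k (s≤s (ℕ.≤-trans (ℕ.m≤n*m k 2) (ℕ.≤-trans (ℕ.n≤1+n _) (ThetaExponent-≤ e))))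
        (trans (cong ((d ℕ.+ 9 ℕ.* k ≡ᵇ 10 ℕ.* k ℕ.* k ℕ.+ 2) ∨_) (≡⇒≡ᵇ (trans d≡eP (eP-odd k)))) (Bool.∨-zeroʳ _))
    ThetaExponent-odd⇒isMinus k d e@(inj₂ (_ , d≡eN)) =
      anyBelow-intro (suc d) (λ j → minusTest j d) (suc k) (s≤s (ℕ.≤-trans (s≤s (ℕ.m≤n*m k 2)) (ThetaExponent-≤ e)))
        (cong (_∨ (d ≡ᵇ 10 ℕ.* suc k ℕ.* suc k ℕ.+ 9 ℕ.* suc k ℕ.+ 2)) (≡⇒≡ᵇ (trans (cong (ℕ._+ 9 ℕ.* suc k) d≡eN) (eN-odd k))))

    a-coeff : ∀ N d → d ≤ N → a d ≡ tripleProduct N d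
    a-coeff N d d≤N with isPlus d in plus | isMinus d in minus
    ... | true | _ with anyBelow-elim (suc d) (λ j → plusTest j d) plus
    ...   | j , _ , test = trans (sym (signPow-even j))
                                 (sym (tripleProduct-exponent N d (2 ℕ.* j) d≤N (plusTest⇒ThetaExponent j d test)))
    a-coeff N d d≤N | false | true with anyBelow-elim (suc d) (λ j → minusTest j d) minus
    ...   | j , _ , test with minusTest⇒ThetaExponent j d test
    ...     | k , e = trans (cong -_ (sym (signPow-even k))) (sym (tripleProduct-exponent N d (suc (2 ℕ.* k)) d≤N e))
    a-coeff N d d≤N | false | false = sym (tripleProduct-gap N d d≤N λ m _ e → not-exponent m e)
      where
      not-exponent : ∀ m → ThetaExponent m d → ⊥
      not-exponent m e with parity m
      ... | k , inj₁ refl = Bool.not-¬ plus (ThetaExponent-even⇒isPlus k d e)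
      ... | k , inj₂ refl = Bool.not-¬ minus (ThetaExponent-odd⇒isMinus k d e)

open import Defs
open import Data.Nat using (ℕ; _∸_)
open import Data.Integer using (ℤ; +_; _*_)
open import Relation.Binary.PropositionalEquality using (_≡_)

open import Data.Nat as ℕ using (suc)
import Data.Nat.Properties as ℕ
open import Data.Nat.Tactic.RingSolver using (solve-∀)
open import Relation.Binary.PropositionalEquality using (cong; sym; trans; module ≡-Reasoning)
open FiniteSums using (∑)
open PowerSeries
open Compositions
open Partitions
open ProductIdentities
open Decoding

-- SignedCompositions.count isP5 is signedCount by definition.
open SignedCompositions isP5 using (denominator; denominator-⊛-count)
open RestrictedPartitions isPm1mod5 using (bounded; forbiddenFactor; bounded-⊛-euler; partitionCount-bounded)

rrSeries : Series
rrSeries n = + rr n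

rrSeries-⊛-denominator : ∀ d → (rrSeries ⊛ denominator) d ≡ a d
rrSeries-⊛-denominator d = begin
  (rrSeries ⊛ denominator) d                 ≡⟨ ⊛-cong-≈[<] rr≈bounded denominator≈euler d ℕ.≤-refl ⟩
  (bounded M ⊛ Euler.tripleProduct N₁) d     ≡⟨ at (⊛-congˡ (bounded M) (tripleProduct-euler N₁)) d ⟩
  (bounded M ⊛ euler M) d                    ≡⟨ at (bounded-⊛-euler M) d ⟩
  ∏ forbiddenFactor M d                      ≡⟨ cong (λ k → ∏ forbiddenFactor k d) (M≡5N₂ d) ⟩
  ∏ forbiddenFactor (5 ℕ.* N₂) d             ≡⟨ at (tripleProduct-rogersRamanujan N₂) d ⟨
  RogersRamanujan.tripleProduct N₂ d         ≡⟨ RogersRamanujanExponents.a-coeff N₂ d (ℕ.m≤n*m d 3) ⟨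
  a d                                        ∎
  where
  open ≡-Reasoning
  N₁ N₂ M : ℕ
  N₁ = 5 ℕ.* d
  N₂ = 3 ℕ.* d
  M = 3 ℕ.* N₁
  M≡5N₂ : ∀ d → 3 ℕ.* (5 ℕ.* d) ≡ 5 ℕ.* (3 ℕ.* d)
  M≡5N₂ = solve-∀
  rr≈bounded : rrSeries ≈[< suc d ] bounded M
  rr≈bounded n n≤d = partitionCount-bounded M n (ℕ.≤-trans (ℕ.≤-pred n≤d) (ℕ.≤-trans (ℕ.m≤n*m d 5) (ℕ.m≤n*m N₁ 3)))
  denominator≈euler : denominator ≈[< suc d ] Euler.tripleProduct N₁
  denominator≈euler n n≤d = PentagonalNumbers.denominator-coeff N₁ n (ℕ.≤-trans (ℕ.≤-pred n≤d) (ℕ.m≤n*m d 5))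

rrSeries≈a⊛signedCount : rrSeries ≈ a ⊛ signedCount
rrSeries≈a⊛signedCount = begin
  rrSeries                              ≈⟨ ⊛-identityʳ rrSeries ⟨
  rrSeries ⊛ 𝟙                          ≈⟨ ⊛-congˡ rrSeries denominator-⊛-count ⟨
  rrSeries ⊛ (denominator ⊛ signedCount) ≈⟨ ⊛-assoc rrSeries denominator signedCount ⟨
  (rrSeries ⊛ denominator) ⊛ signedCount ≈⟨ ⊛-congʳ signedCount (mk≈ rrSeries-⊛-denominator) ⟩
  a ⊛ signedCount                       ∎
  where open ≈-Reasoning

sumTo-∑ : ∀ n f → sumTo n f ≡ ∑ (suc n) f
sumTo-∑ n f = sumBy-applyUpTo f (λ i → i) (suc n)

mainTheorem12 : (n : ℕ) → + (rr n) ≡ sumTo n (λ i → a i * signedCount (n ∸ i))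
mainTheorem12 n = trans (at rrSeries≈a⊛signedCount n) (sym (sumTo-∑ n (λ i → a i * signedCount (n ∸ i))))
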